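{- Let $p$ be an even positive integer and $\tau,i,j$ non-negative integers. Let $\mu=\frac{p^2}{4}+2p+2$, $\gamma=2\mu-\left(\frac p2+4\right)$, $m=\mu+\tau\frac p2$, $g=\gamma+\tau(p-1)$, $c=p\mu+\tau\left(\frac{p^2}{2}-1\right)$, $S(p,\tau)=\langle m,g,g+1\rangle_c$; and let $m^{(i,j)}=m+j\frac p2$, $g^{(i,j)}=g+j(p-1)+i\,m^{(i,j)}$, $c^{(i,j)}=c+j\frac{p^2}{2}+i\left(\frac p2+1\right)m^{(i,j)}$, $S^{(i,j)}(p,\tau)=\langle m^{(i,j)},g^{(i,j)},g^{(i,j)}+1\rangle_{c^{(i,j)}}$. Then $$\mathrm{E}(S^{(i,j)}(p,\tau))=\mathrm{E}(S(p,\tau)).$$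
   Context: A numerical semigroup is a submonoid of $(\mathbb N,+)$ with finite complement. For integers $a_1,\dots,a_r$ and $t$, $\langle a_1,\dots,a_r\rangle_t$ denotes the smallest numerical semigroup containing $a_1,\dots,a_r$ and all integers $\ge t$. For a numerical semigroup $S$: conductor $c(S)$ is the smallest integer such that all integers $\ge c(S)$ are in $S$; multiplicity $m(S)$ is its least positive element; $L=\{s\in S: s<c(S)\}$; $P$ is the set of minimal generators; $q=\lceil c(S)/m(S)\rceil$; $\rho=q\,m(S)-c(S)$; $I_q=\{z\in\mathbb Z: c(S)\le z<c(S)+m(S)\}$; $D_q=I_q\setminus P$. The Eliahou number is $\mathrm{E}(S)=|P\cap L|\,|L|-q\,|D_q|+\rho$. -}

module Defs where

open import Data.Nat using (ℕ; zero; suc; _+_; _*_; _∸_; _≤ᵇ_; _<ᵇ_; _≡ᵇ_)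
open import Data.Nat.DivMod using (_/_)
open import Data.Bool using (Bool; true; false; if_then_else_; _∧_; _∨_; not)
open import Data.List using (List; upTo; filter; length; map)
open import Data.Bool.ListAction using (any)
open import Data.Integer as ℤ using (ℤ; +_)
open import Relation.Nullary.Decidable using (Dec)
open import Relation.Binary.PropositionalEquality using (_≡_)

-- n is an ℕ-linear combination x*a + y*b + z*d (any such combination
-- of n with positive generators has x,y,z ≤ n; we search x,y,z ≤ n,
-- which is also exact when some generator is 0).
inSpan3 : ℕ → ℕ → ℕ → ℕ → Bool
inSpan3 a b d n =
  any (λ x → any (λ y → any (λ z → (x * a + y * b + z * d) ≡ᵇ n)
                              (upTo (suc n)))
                   (upTo (suc n)))
      (upTo (suc n))

-- Membership in ⟨a , b , d⟩_t : the smallest numerical semigroup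
-- containing a, b, d and all integers ≥ t.  It consists of the
-- ℕ-combinations of a, b, d together with all integers ≥ t.
gen3 : ℕ → ℕ → ℕ → ℕ → (ℕ → Bool)
gen3 a b d t n = (t ≤ᵇ n) ∨ inSpan3 a b d n

-- Invariants of a numerical semigroup S given by membership test S and
-- a bound N such that every n ≥ N lies in S.

-- least c ≤ N such that every k with c ≤ k < N is in S  (= conductor)
conductorFrom : (ℕ → Bool) → ℕ → ℕ
conductorFrom S zero = zero
conductorFrom S (suc n) = if S n then conductorFrom S n else suc n

firstFrom : (ℕ → Bool) → ℕ → ℕ → ℕ
firstFrom S start zero = start
firstFrom S start (suc fuel) = if S start then start else firstFrom S (suc start) fuel

-- multiplicity: least positive element (N+1 ∈ S, so search 1..N+1 suffices)
multiplicityFrom : (ℕ → Bool) → ℕ → ℕ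
multiplicityFrom S N = firstFrom S 1 N

isMinGen : (ℕ → Bool) → ℕ → Bool
isMinGen S s = (1 ≤ᵇ s) ∧ S s ∧
  not (any (λ a → (1 ≤ᵇ a) ∧ S a ∧ S (s ∸ a)) (upTo s))

count : (ℕ → Bool) → List ℕ → ℕ
count f xs = length (filter (λ x → f x Data.Bool.≟ true) xs)

ceilDiv : ℕ → ℕ → ℕ
ceilDiv c zero = zero
ceilDiv c (suc k) = (c + k) / suc k

-- Eliahou number  E(S) = |P ∩ L| |L| - q |D_q| + ρ
eliahouFrom : (ℕ → Bool) → ℕ → ℤ
eliahouFrom S N =
  let c  = conductorFrom S N
      m  = multiplicityFrom S N
      Lc = upTo c
      L  = count S Lc
      PL = count (isMinGen S) Lc
      q  = ceilDiv c m
      ρ  = q * m ∸ c                        -- q m - c  (always ≥ 0)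
      Dq = count (λ z → not (isMinGen S z)) (map (λ k → c + k) (upTo m))
  in (+ (PL * L) ℤ.- + (q * Dq)) ℤ.+ + ρ

E-gen : ℕ → ℕ → ℕ → ℤ
E-gen a b t = eliahouFrom (gen3 a b (suc b) t) t

module Submission where

-- Write h = p/2 and E = h + τ + j + 3.  Then m⁽ⁱʲ⁾ = M = 2 + h(E + 1), g⁽ⁱʲ⁾ + E + 1 = uM and
-- c⁽ⁱʲ⁾ = QM − τ, where u = 2 + i and Q = uh + i.  A combination aM + y g + z (g + 1) with
-- k = y + z equals (a + uk)M − (kE + (k − z)), so an element x below the conductor sits at
-- a level ℓ with an offset x = ℓM − (kE + s), and it lies in S exactly when s ≤ k and uk ≤ ℓ.
-- Counting level by level, |L| = Σ_{ℓ=1..Q} Σ_{k ≤ h, uk ≤ ℓ} (k + 1); the only minimal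
-- generators below c are M, g and g + 1; q = Q and ρ = τ; and the window [c, c + M) holds
-- (h + 3) + Σ_{k=1..h} (k + 1) non-generators.  With these closed forms the Eliahou number
-- is τ − h(h − 1)/2, in which neither i nor j occurs.

open import Defs
open import Data.Nat using (ℕ; zero; suc; _+_; _*_; _∸_; _≤_; _<_; _≤ᵇ_; z≤n; s≤s; z<s; s<s; >-nonZero)
open import Data.Nat.Properties
open import Algebra.Properties.CommutativeSemigroup +-commutativeSemigroup using (xy∙z≈xz∙y)
open import Data.Nat.DivMod using (_/_; _%_; m*n/n≡m; m≡m%n+[m/n]*n; m%n<n)
open import Data.Nat.Divisibility using (_∣_; divides)
open import Data.Nat.Tactic.RingSolver using (solve-∀)
open import Data.Integer as ℤ using (_⊖_)
import Data.Integer.Properties as ℤ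
open import Data.Bool using (Bool; true; false; _∧_; _∨_; not; if_then_else_)
open import Data.Bool.Properties using (T-≡; ⇔→≡; ∨-zeroʳ; ∧-zeroʳ; not-involutive; ¬-not)
open import Data.Bool.ListAction using (any)
open import Data.List using ([]; _∷_; upTo; applyUpTo; map)
open import Data.List.Membership.Propositional using (find; lose)
open import Data.List.Membership.Propositional.Properties using (∈-upTo⁺; ∈-upTo⁻)
open import Data.List.Relation.Unary.Any.Properties using (any⁺; any⁻)
open import Data.Product using (∃-syntax; _×_; _,_; proj₁; proj₂)
open import Data.Sum using (_⊎_; inj₁; inj₂)
open import Data.Empty using (⊥)
open import Function.Base using (_∘_)
open import Function.Bundles using (Equivalence; mk⇔)
open import Relation.Binary.Definitions using (tri<; tri≈; tri>)
open import Relation.Binary.PropositionalEquality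
open import Relation.Nullary using (Dec; yes; no; contradiction)

fromBool : Bool → ℕ
fromBool true = 1
fromBool false = 0

m∸n≡1+[m∸1+n] : ∀ {m n} → n < m → m ∸ n ≡ suc (m ∸ suc n)
m∸n≡1+[m∸1+n] {suc m} {zero} _ = refl
m∸n≡1+[m∸1+n] {suc m} {suc n} (s<s n<m) = m∸n≡1+[m∸1+n] n<m

≤⇒≤ᵇ≡true : ∀ {m n} → m ≤ n → (m ≤ᵇ n) ≡ true
≤⇒≤ᵇ≡true m≤n = Equivalence.to T-≡ (≤⇒≤ᵇ m≤n)

≤ᵇ≡true⇒≤ : ∀ m n → (m ≤ᵇ n) ≡ true → m ≤ n
≤ᵇ≡true⇒≤ m n m≤ᵇn = ≤ᵇ⇒≤ m n (Equivalence.from T-≡ m≤ᵇn)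

>⇒≤ᵇ≡false : ∀ {m n} → n < m → (m ≤ᵇ n) ≡ false
>⇒≤ᵇ≡false {m} {n} n<m = ¬-not (λ m≤ᵇn → <⇒≱ n<m (≤ᵇ≡true⇒≤ m n m≤ᵇn))

countBelow : (ℕ → Bool) → ℕ → ℕ
countBelow f zero = 0
countBelow f (suc n) = fromBool (f 0) + countBelow (λ x → f (suc x)) n

count-∷ : ∀ (f : ℕ → Bool) x xs → count f (x ∷ xs) ≡ fromBool (f x) + count f xs
count-∷ f x xs with f x
... | true = refl
... | false = refl

count-applyUpTo : ∀ (f : ℕ → Bool) g n → count f (applyUpTo g n) ≡ countBelow (λ x → f (g x)) n
count-applyUpTo f g zero = refl
count-applyUpTo f g (suc n) = trans (count-∷ f (g 0) (applyUpTo (λ x → g (suc x)) n))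
  (cong (fromBool (f (g 0)) +_) (count-applyUpTo f (λ x → g (suc x)) n))

count-upTo : ∀ (f : ℕ → Bool) n → count f (upTo n) ≡ countBelow f n
count-upTo f = count-applyUpTo f (λ x → x)

count-map : ∀ (f : ℕ → Bool) g xs → count f (map g xs) ≡ count (λ x → f (g x)) xs
count-map f g [] = refl
count-map f g (x ∷ xs) = begin
  count f (g x ∷ map g xs)                      ≡⟨ count-∷ f (g x) (map g xs) ⟩
  fromBool (f (g x)) + count f (map g xs)       ≡⟨ cong (fromBool (f (g x)) +_) (count-map f g xs) ⟩
  fromBool (f (g x)) + count (λ y → f (g y)) xs ≡⟨ count-∷ (λ y → f (g y)) x xs ⟨
  count (λ y → f (g y)) (x ∷ xs)                ∎
  where open ≡-Reasoning

count-map-upTo : ∀ (f : ℕ → Bool) c n → count f (map (λ k → c + k) (upTo n)) ≡ countBelow (λ x → f (c + x)) n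
count-map-upTo f c n = trans (count-map f (c +_) (upTo n)) (count-upTo (λ x → f (c + x)) n)

countBelow-cong : ∀ {f g : ℕ → Bool} n → (∀ x → x < n → f x ≡ g x) → countBelow f n ≡ countBelow g n
countBelow-cong zero f≗g = refl
countBelow-cong (suc n) f≗g = cong₂ _+_ (cong fromBool (f≗g 0 z<s))
  (countBelow-cong n (λ x x<n → f≗g (suc x) (s<s x<n)))

countBelow-+ : ∀ (f : ℕ → Bool) m n → countBelow f (m + n) ≡ countBelow f m + countBelow (λ x → f (m + x)) n
countBelow-+ f zero n = refl
countBelow-+ f (suc m) n = trans (cong (fromBool (f 0) +_) (countBelow-+ (λ x → f (suc x)) m n))
  (sym (+-assoc (fromBool (f 0)) _ _))

countBelow-const : ∀ {f : ℕ → Bool} b n → (∀ x → x < n → f x ≡ b) → countBelow f n ≡ fromBool b * n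
countBelow-const b zero f≡b = sym (*-zeroʳ (fromBool b))
countBelow-const b (suc n) f≡b = trans
  (cong₂ _+_ (cong fromBool (f≡b 0 z<s)) (countBelow-const b n (λ x x<n → f≡b (suc x) (s<s x<n))))
  (sym (*-suc (fromBool b) n))

countBelow-false : ∀ {f : ℕ → Bool} n → (∀ x → x < n → f x ≡ false) → countBelow f n ≡ 0
countBelow-false = countBelow-const false

countBelow-true : ∀ {f : ℕ → Bool} n → (∀ x → x < n → f x ≡ true) → countBelow f n ≡ n
countBelow-true n f≡true = trans (countBelow-const true n f≡true) (+-identityʳ n)

countBelow-suc : ∀ (f : ℕ → Bool) n → countBelow f (suc n) ≡ countBelow f n + fromBool (f n)
countBelow-suc f n = begin
  countBelow f (suc n)                        ≡⟨ cong (countBelow f) (+-comm 1 n) ⟩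
  countBelow f (n + 1)                        ≡⟨ countBelow-+ f n 1 ⟩
  countBelow f n + (fromBool (f (n + 0)) + 0) ≡⟨ cong (countBelow f n +_) (+-identityʳ _) ⟩
  countBelow f n + fromBool (f (n + 0))       ≡⟨ cong (λ x → countBelow f n + fromBool (f x)) (+-identityʳ n) ⟩
  countBelow f n + fromBool (f n)             ∎
  where open ≡-Reasoning

countBelow-single : ∀ (f : ℕ → Bool) {n} p → p < n → f p ≡ true → (∀ x → x < n → x ≢ p → f x ≡ false) →
                    countBelow f n ≡ 1
countBelow-single f {n} p p<n fp≡true others≡false with r , 1+p+r≡n ← m≤n⇒∃[o]m+o≡n p<n = begin
  countBelow f n                                   ≡⟨ cong (countBelow f) n≡p+[1+r] ⟩
  countBelow f (p + suc r)                         ≡⟨ countBelow-+ f p (suc r) ⟩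
  countBelow f p + (fromBool (f (p + 0)) + countBelow (λ y → f (p + suc y)) r)
                                                   ≡⟨ cong₂ _+_ before (cong₂ _+_ (cong fromBool at) after) ⟩
  1                                                ∎
  where
  open ≡-Reasoning
  n≡p+[1+r] : n ≡ p + suc r
  n≡p+[1+r] = trans (sym 1+p+r≡n) (sym (+-suc p r))
  before : countBelow f p ≡ 0
  before = countBelow-false p (λ x x<p → others≡false x (<-trans x<p p<n) (<⇒≢ x<p))
  at : f (p + 0) ≡ true
  at = trans (cong f (+-identityʳ p)) fp≡true
  after : countBelow (λ y → f (p + suc y)) r ≡ 0
  after = countBelow-false r (λ y y<r → others≡false (p + suc y)
    (subst (p + suc y <_) (sym n≡p+[1+r]) (+-monoʳ-< p (s<s y<r))) (>⇒≢ (m<m+n p z<s)))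

countBelow-slide : ∀ (f : ℕ → Bool) a m d →
                   countBelow (λ t → f (a + t)) m + countBelow (λ t → f (a + m + t)) d ≡
                   countBelow (λ t → f (a + t)) d + countBelow (λ t → f (a + d + t)) m
countBelow-slide f a m d = begin
  countBelow g m + countBelow (λ t → f (a + m + t)) d ≡⟨ cong (countBelow g m +_) (reassociate m d) ⟩
  countBelow g m + countBelow (λ t → g (m + t)) d     ≡⟨ countBelow-+ g m d ⟨
  countBelow g (m + d)                                ≡⟨ cong (countBelow g) (+-comm m d) ⟩
  countBelow g (d + m)                                ≡⟨ countBelow-+ g d m ⟩
  countBelow g d + countBelow (λ t → g (d + t)) m     ≡⟨ cong (countBelow g d +_) (reassociate d m) ⟨
  countBelow g d + countBelow (λ t → f (a + d + t)) m ∎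
  where
  open ≡-Reasoning
  g : ℕ → Bool
  g t = f (a + t)
  reassociate : ∀ b n → countBelow (λ t → f (a + b + t)) n ≡ countBelow (λ t → g (b + t)) n
  reassociate b n = countBelow-cong n (λ t _ → cong f (+-assoc a b t))

countBelow-reverse : ∀ (f : ℕ → Bool) n → countBelow f n ≡ countBelow (λ e → f (n ∸ suc e)) n
countBelow-reverse f zero = refl
countBelow-reverse f (suc n) = begin
  fromBool (f 0) + countBelow (λ x → f (suc x)) n
    ≡⟨ cong (fromBool (f 0) +_) (countBelow-reverse (λ x → f (suc x)) n) ⟩
  fromBool (f 0) + countBelow (λ e → f (suc (n ∸ suc e))) n
    ≡⟨ +-comm (fromBool (f 0)) _ ⟩
  countBelow (λ e → f (suc (n ∸ suc e))) n + fromBool (f 0)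
    ≡⟨ cong₂ _+_ (countBelow-cong n (λ e e<n → cong f (sym (m∸n≡1+[m∸1+n] e<n))))
                 (cong (λ x → fromBool (f x)) (sym (n∸n≡0 n))) ⟩
  countBelow (λ e → f (n ∸ e)) n + fromBool (f (n ∸ n))
    ≡⟨ countBelow-suc (λ e → f (n ∸ e)) n ⟨
  countBelow (λ e → f (n ∸ e)) (suc n) ∎
  where open ≡-Reasoning

countBelow-reflect : ∀ (f : ℕ → Bool) a n L → a + n ≡ suc L →
                     countBelow (λ y → f (a + y)) n ≡ countBelow (λ e → f (L ∸ e)) n
countBelow-reflect f a n L a+n≡1+L = trans (countBelow-reverse (λ y → f (a + y)) n)
  (countBelow-cong n (λ e e<n → cong f (begin
    a + (n ∸ suc e) ≡⟨ +-∸-assoc a e<n ⟨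
    a + n ∸ suc e   ≡⟨ cong (_∸ suc e) a+n≡1+L ⟩
    L ∸ e           ∎)))
  where open ≡-Reasoning

sumFrom : (ℕ → ℕ) → ℕ → ℕ → ℕ
sumFrom f k₀ zero = 0
sumFrom f k₀ (suc n) = f k₀ + sumFrom f (suc k₀) n

sumFrom-cong : ∀ f g k₀ n → (∀ k → k₀ ≤ k → k < k₀ + n → f k ≡ g k) → sumFrom f k₀ n ≡ sumFrom g k₀ n
sumFrom-cong f g k₀ zero f≗g = refl
sumFrom-cong f g k₀ (suc n) f≗g = cong₂ _+_ (f≗g k₀ ≤-refl (m<m+n k₀ z<s))
  (sumFrom-cong f g (suc k₀) n (λ k k₀<k k<k₀+1+n → f≗g k (<⇒≤ k₀<k) (subst (k <_) (sym (+-suc k₀ n)) k<k₀+1+n)))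

sumFrom-suc : ∀ f k₀ n → sumFrom f k₀ (suc n) ≡ sumFrom f k₀ n + f (k₀ + n)
sumFrom-suc f k₀ zero = trans (+-identityʳ (f k₀)) (cong f (sym (+-identityʳ k₀)))
sumFrom-suc f k₀ (suc n) = begin
  f k₀ + sumFrom f (suc k₀) (suc n)           ≡⟨ cong (f k₀ +_) (sumFrom-suc f (suc k₀) n) ⟩
  f k₀ + (sumFrom f (suc k₀) n + f (suc k₀ + n)) ≡⟨ +-assoc (f k₀) _ _ ⟨
  f k₀ + sumFrom f (suc k₀) n + f (suc k₀ + n) ≡⟨ cong (λ k → f k₀ + sumFrom f (suc k₀) n + f k) (+-suc k₀ n) ⟨
  f k₀ + sumFrom f (suc k₀) n + f (k₀ + suc n) ∎
  where open ≡-Reasoning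

sumFrom-const : ∀ c k₀ n → sumFrom (λ _ → c) k₀ n ≡ n * c
sumFrom-const c k₀ zero = refl
sumFrom-const c k₀ (suc n) = cong (c +_) (sumFrom-const c (suc k₀) n)

sumFrom-+ : ∀ f g k₀ n → sumFrom (λ k → f k + g k) k₀ n ≡ sumFrom f k₀ n + sumFrom g k₀ n
sumFrom-+ f g k₀ zero = refl
sumFrom-+ f g k₀ (suc n) = trans (cong (f k₀ + g k₀ +_) (sumFrom-+ f g (suc k₀) n))
  (interchange (f k₀) (g k₀) _ _)
  where
  interchange : ∀ a b c d → a + b + (c + d) ≡ a + c + (b + d)
  interchange = solve-∀

sumFrom-*ˡ : ∀ f c k₀ n → sumFrom (λ k → c * f k) k₀ n ≡ c * sumFrom f k₀ n
sumFrom-*ˡ f c k₀ zero = sym (*-zeroʳ c)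
sumFrom-*ˡ f c k₀ (suc n) = trans (cong (c * f k₀ +_) (sumFrom-*ˡ f c (suc k₀) n)) (sym (*-distribˡ-+ c (f k₀) _))

sumFrom-*ʳ : ∀ f c k₀ n → sumFrom (λ k → f k * c) k₀ n ≡ sumFrom f k₀ n * c
sumFrom-*ʳ f c k₀ zero = refl
sumFrom-*ʳ f c k₀ (suc n) = trans (cong (f k₀ * c +_) (sumFrom-*ʳ f c (suc k₀) n)) (sym (*-distribʳ-+ c (f k₀) _))

sumFrom-swap : ∀ (F : ℕ → ℕ → ℕ) a n b m →
               sumFrom (λ ℓ → sumFrom (F ℓ) a n) b m ≡ sumFrom (λ k → sumFrom (λ ℓ → F ℓ k) b m) a n
sumFrom-swap F a n b zero = sym (trans (sumFrom-const 0 a n) (*-zeroʳ n))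
sumFrom-swap F a n b (suc m) = trans (cong (sumFrom (F b) a n +_) (sumFrom-swap F a n (suc b) m))
  (sym (sumFrom-+ (F b) (λ k → sumFrom (λ ℓ → F ℓ k) (suc b) m) a n))

sumFrom-≤ᵇ-all : ∀ a b n → a ≤ b → sumFrom (λ ℓ → fromBool (a ≤ᵇ ℓ)) b n ≡ n
sumFrom-≤ᵇ-all a b n a≤b = begin
  sumFrom (λ ℓ → fromBool (a ≤ᵇ ℓ)) b n ≡⟨ sumFrom-cong _ (λ _ → 1) b n above ⟩
  sumFrom (λ _ → 1) b n                 ≡⟨ sumFrom-const 1 b n ⟩
  n * 1                                 ≡⟨ *-identityʳ n ⟩
  n                                     ∎
  where
  open ≡-Reasoning
  above : ∀ ℓ → b ≤ ℓ → ℓ < b + n → fromBool (a ≤ᵇ ℓ) ≡ 1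
  above ℓ b≤ℓ _ = cong fromBool (≤⇒≤ᵇ≡true (≤-trans a≤b b≤ℓ))

sumFrom-≤ᵇ : ∀ a b n → b ≤ a → a ≤ b + n → sumFrom (λ ℓ → fromBool (a ≤ᵇ ℓ)) b n + a ≡ b + n
sumFrom-≤ᵇ a b zero b≤a a≤b+0 = trans (≤-antisym (subst (a ≤_) (+-identityʳ b) a≤b+0) b≤a) (sym (+-identityʳ b))
sumFrom-≤ᵇ a b (suc n) b≤a a≤b+1+n with m≤n⇒m<n∨m≡n b≤a
... | inj₂ refl rewrite ≤⇒≤ᵇ≡true (≤-refl {a}) =
  trans (cong (λ z → suc z + a) (sumFrom-≤ᵇ-all a (suc a) n (n≤1+n a))) (+-comm (suc n) a)
... | inj₁ b<a rewrite >⇒≤ᵇ≡false b<a =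
  trans (sumFrom-≤ᵇ a (suc b) n b<a (subst (a ≤_) (+-suc b n) a≤b+1+n)) (sym (+-suc b n))

sumFrom-telescope : ∀ (f F : ℕ → ℕ) c n → F 0 ≡ 0 → (∀ k → F k + c * f (suc k) ≡ F (suc k)) →
                    c * sumFrom f 1 n ≡ F n
sumFrom-telescope f F c zero F0≡0 step = trans (*-zeroʳ c) (sym F0≡0)
sumFrom-telescope f F c (suc n) F0≡0 step = begin
  c * sumFrom f 1 (suc n)               ≡⟨ cong (c *_) (sumFrom-suc f 1 n) ⟩
  c * (sumFrom f 1 n + f (suc n))       ≡⟨ *-distribˡ-+ c _ (f (suc n)) ⟩
  c * sumFrom f 1 n + c * f (suc n)     ≡⟨ cong (_+ c * f (suc n)) (sumFrom-telescope f F c n F0≡0 step) ⟩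
  F n + c * f (suc n)                   ≡⟨ step n ⟩
  F (suc n)                             ∎
  where open ≡-Reasoning

triangular : ℕ → ℕ
triangular = sumFrom (λ k → k) 1

triangular-closed : ∀ n → 2 * triangular n ≡ n * suc n
triangular-closed n = sumFrom-telescope (λ k → k) (λ k → k * suc k) 2 n refl step
  where
  step : ∀ k → k * suc k + 2 * suc k ≡ suc k * suc (suc k)
  step = solve-∀

sumFrom-suc-closed : ∀ n → 2 * sumFrom suc 1 n ≡ n * (n + 3)
sumFrom-suc-closed n = sumFrom-telescope suc (λ k → k * (k + 3)) 2 n refl step
  where
  step : ∀ k → k * (k + 3) + 2 * suc (suc k) ≡ suc k * (suc k + 3)
  step = solve-∀

sumFrom-pronic-closed : ∀ n → 3 * sumFrom (λ k → k * suc k) 1 n ≡ n * suc n * suc (suc n)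
sumFrom-pronic-closed n = sumFrom-telescope (λ k → k * suc k) (λ k → k * suc k * suc (suc k)) 3 n refl step
  where
  step : ∀ k → k * suc k * suc (suc k) + 3 * (suc k * suc (suc k)) ≡ suc k * suc (suc k) * suc (suc (suc k))
  step = solve-∀

countBelow-blocks : ∀ (f : ℕ → Bool) (block : ℕ → ℕ) E k₀ n R →
  (∀ k → k₀ ≤ k → k < k₀ + n → countBelow (λ y → f (k * E + y)) E ≡ block k) →
  countBelow (λ y → f (k₀ * E + y)) (n * E + R) ≡ sumFrom block k₀ n + countBelow (λ y → f ((k₀ + n) * E + y)) R
countBelow-blocks f block E k₀ zero R blocks≡ =
  countBelow-cong R (λ y _ → cong (λ k → f (k * E + y)) (sym (+-identityʳ k₀)))
countBelow-blocks f block E k₀ (suc n) R blocks≡ = begin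
  countBelow (λ y → f (k₀ * E + y)) (E + n * E + R)
    ≡⟨ cong (countBelow (λ y → f (k₀ * E + y))) (+-assoc E (n * E) R) ⟩
  countBelow (λ y → f (k₀ * E + y)) (E + (n * E + R))
    ≡⟨ countBelow-+ (λ y → f (k₀ * E + y)) E (n * E + R) ⟩
  countBelow (λ y → f (k₀ * E + y)) E + countBelow (λ y → f (k₀ * E + (E + y))) (n * E + R)
    ≡⟨ cong₂ _+_ (blocks≡ k₀ ≤-refl (m<m+n k₀ z<s)) (countBelow-cong (n * E + R) (λ y _ → cong f (shift y))) ⟩
  block k₀ + countBelow (λ y → f (suc k₀ * E + y)) (n * E + R)
    ≡⟨ cong (block k₀ +_) (countBelow-blocks f block E (suc k₀) n R (λ k k₀<k k<1+k₀+n →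
         blocks≡ k (<⇒≤ k₀<k) (subst (k <_) (sym (+-suc k₀ n)) k<1+k₀+n))) ⟩
  block k₀ + (sumFrom block (suc k₀) n + countBelow (λ y → f ((suc k₀ + n) * E + y)) R)
    ≡⟨ +-assoc (block k₀) _ _ ⟨
  block k₀ + sumFrom block (suc k₀) n + countBelow (λ y → f ((suc k₀ + n) * E + y)) R
    ≡⟨ cong (λ k → block k₀ + sumFrom block (suc k₀) n + countBelow (λ y → f (k * E + y)) R) (+-suc k₀ n) ⟨
  block k₀ + sumFrom block (suc k₀) n + countBelow (λ y → f ((k₀ + suc n) * E + y)) R ∎
  where
  open ≡-Reasoning
  shift : ∀ y → k₀ * E + (E + y) ≡ suc k₀ * E + y
  shift y = trans (sym (+-assoc (k₀ * E) E y)) (cong (_+ y) (+-comm (k₀ * E) E))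

any-upTo⁻ : ∀ (p : ℕ → Bool) n → any p (upTo n) ≡ true → ∃[ x ] (x < n × p x ≡ true)
any-upTo⁻ p n any≡true with x , x∈ , px ← find (any⁻ p (upTo n) (Equivalence.from T-≡ any≡true)) =
  x , ∈-upTo⁻ x∈ , Equivalence.to T-≡ px

any-upTo⁺ : ∀ (p : ℕ → Bool) {n} x → x < n → p x ≡ true → any p (upTo n) ≡ true
any-upTo⁺ p x x<n px = Equivalence.to T-≡ (any⁺ p (lose (∈-upTo⁺ x<n) (Equivalence.from T-≡ px)))

inSpan3-sound : ∀ a b d n → inSpan3 a b d n ≡ true → ∃[ x ] ∃[ y ] ∃[ z ] (x * a + y * b + z * d ≡ n)
inSpan3-sound a b d n span
  with x , _ , ∃yz ← any-upTo⁻ _ (suc n) span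
  with y , _ , ∃z ← any-upTo⁻ _ (suc n) ∃yz
  with z , _ , sum≡ᵇn ← any-upTo⁻ _ (suc n) ∃z
  = x , y , z , ≡ᵇ⇒≡ _ n (Equivalence.from T-≡ sum≡ᵇn)

inSpan3-complete : ∀ a b d {n} x y z → 0 < a → 0 < b → 0 < d → x * a + y * b + z * d ≡ n → inSpan3 a b d n ≡ true
inSpan3-complete a b d {n} x y z 0<a 0<b 0<d sum≡n =
  any-upTo⁺ _ x (coefficient<1+n 0<a x*a≤n) (any-upTo⁺ _ y (coefficient<1+n 0<b y*b≤n)
    (any-upTo⁺ _ z (coefficient<1+n 0<d z*d≤n) (Equivalence.to T-≡ (≡⇒≡ᵇ _ n sum≡n))))
  where
  coefficient<1+n : ∀ {c v} → 0 < v → c * v ≤ n → c < suc n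
  coefficient<1+n {c} {v} 0<v cv≤n = s≤s (≤-trans (m≤m*n c v ⦃ >-nonZero 0<v ⦄) cv≤n)
  x*a≤n : x * a ≤ n
  x*a≤n = subst (x * a ≤_) sum≡n (≤-trans (m≤m+n _ (y * b)) (m≤m+n _ (z * d)))
  y*b≤n : y * b ≤ n
  y*b≤n = subst (y * b ≤_) sum≡n (≤-trans (m≤n+m (y * b) (x * a)) (m≤m+n _ (z * d)))
  z*d≤n : z * d ≤ n
  z*d≤n = subst (z * d ≤_) sum≡n (m≤n+m (z * d) _)

firstFrom-≡ : ∀ (f : ℕ → Bool) start fuel target → start ≤ target → target ≤ start + fuel →
              (∀ k → start ≤ k → k < target → f k ≡ false) → f target ≡ true → firstFrom f start fuel ≡ target
firstFrom-≡ f start zero target start≤target target≤start+0 _ _ =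
  ≤-antisym start≤target (subst (target ≤_) (+-identityʳ start) target≤start+0)
firstFrom-≡ f start (suc fuel) target start≤target target≤ before≡false at≡true with m≤n⇒m<n∨m≡n start≤target
... | inj₂ refl rewrite at≡true = refl
... | inj₁ start<target rewrite before≡false start ≤-refl start<target =
  firstFrom-≡ f (suc start) fuel target start<target (subst (target ≤_) (+-suc start fuel) target≤)
    (λ k start<k k<target → before≡false k (<⇒≤ start<k) k<target) at≡true

quotient-<⇒< : ∀ N {k s k' s'} → s < N → k < k' → k * N + s < k' * N + s'
quotient-<⇒< N {k} {s} {k'} {s'} s<N k<k' = begin-strict
  k * N + s   <⟨ +-monoʳ-< (k * N) s<N ⟩
  k * N + N   ≡⟨ +-comm (k * N) N ⟩
  suc k * N   ≤⟨ *-monoˡ-≤ N k<k' ⟩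
  k' * N      ≤⟨ m≤m+n (k' * N) s' ⟩
  k' * N + s' ∎
  where open ≤-Reasoning

quotient-unique : ∀ N k s k' s' → k * N + s ≡ k' * N + s' → s < N → s' < N → k ≡ k'
quotient-unique N k s k' s' eq s<N s'<N with <-cmp k k'
... | tri< k<k' _ _ = contradiction eq (<⇒≢ (quotient-<⇒< N s<N k<k'))
... | tri≈ _ k≡k' _ = k≡k'
... | tri> _ _ k>k' = contradiction (sym eq) (<⇒≢ (quotient-<⇒< N s'<N k>k'))

remainder-unique : ∀ N k s k' s' → k * N + s ≡ k' * N + s' → s < N → s' < N → s ≡ s'
remainder-unique N k s k' s' eq s<N s'<N with refl ← quotient-unique N k s k' s' eq s<N s'<N =
  +-cancelˡ-≡ (k * N) s s' eq

leastMultiple-≤ : ∀ N {x e e' ℓ ℓ'} → x + e ≡ ℓ * N → x + e' ≡ ℓ' * N → e < N → ℓ ≤ ℓ'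
leastMultiple-≤ N {x} {e} {e'} {ℓ} {ℓ'} x+e≡ℓN x+e'≡ℓ'N e<N = ≮⇒≥ λ ℓ'<ℓ → <-irrefl refl (begin-strict
  ℓ' * N + N  ≡⟨ +-comm (ℓ' * N) N ⟩
  suc ℓ' * N  ≤⟨ *-monoˡ-≤ N ℓ'<ℓ ⟩
  ℓ * N       ≡⟨ x+e≡ℓN ⟨
  x + e       <⟨ +-monoʳ-< x e<N ⟩
  x + N       ≤⟨ +-monoˡ-≤ N (subst (x ≤_) x+e'≡ℓ'N (m≤m+n x e')) ⟩
  ℓ' * N + N  ∎)
  where open ≤-Reasoning

leastMultiple-unique : ∀ N {x e e' ℓ ℓ'} → x + e ≡ ℓ * N → x + e' ≡ ℓ' * N → e < N → e' < N → ℓ ≡ ℓ'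
leastMultiple-unique N x+e≡ℓN x+e'≡ℓ'N e<N e'<N =
  ≤-antisym (leastMultiple-≤ N x+e≡ℓN x+e'≡ℓ'N e<N) (leastMultiple-≤ N x+e'≡ℓ'N x+e≡ℓN e'<N)

ceilDiv-≡ : ∀ c m q τ → c + τ ≡ q * suc m → τ ≤ m → ceilDiv c (suc m) ≡ q
ceilDiv-≡ c m q τ c+τ≡q[1+m] τ≤m =
  quotient-unique (suc m) _ _ q (m ∸ τ) division (m%n<n (c + m) (suc m)) (s≤s (m∸n≤m m τ))
  where
  open ≡-Reasoning
  c+m≡ : c + m ≡ q * suc m + (m ∸ τ)
  c+m≡ = begin
    c + m                ≡⟨ cong (c +_) (m+[n∸m]≡n τ≤m) ⟨
    c + (τ + (m ∸ τ))    ≡⟨ +-assoc c τ _ ⟨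
    c + τ + (m ∸ τ)      ≡⟨ cong (_+ (m ∸ τ)) c+τ≡q[1+m] ⟩
    q * suc m + (m ∸ τ)  ∎
  division : (c + m) / suc m * suc m + (c + m) % suc m ≡ q * suc m + (m ∸ τ)
  division = trans (+-comm _ ((c + m) % suc m)) (trans (sym (m≡m%n+[m/n]*n (c + m) (suc m))) c+m≡)

eliahouFrom-≡ : ∀ (S : ℕ → Bool) N {c m} → conductorFrom S N ≡ c → multiplicityFrom S N ≡ m →
  eliahouFrom S N ≡ (ℤ.+ (countBelow (isMinGen S) c * countBelow S c)
                     ℤ.- ℤ.+ (ceilDiv c m * countBelow (λ t → not (isMinGen S (c + t))) m))
                    ℤ.+ ℤ.+ (ceilDiv c m * m ∸ c)
eliahouFrom-≡ S N {c} {m} refl refl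
  rewrite count-upTo (isMinGen S) c | count-upTo S c | count-map-upTo (λ z → not (isMinGen S z)) c m = refl

[a-b]+τ≡τ⊖t : ∀ {a b} t τ → a + t ≡ b → (ℤ.+ a ℤ.- ℤ.+ b) ℤ.+ ℤ.+ τ ≡ τ ⊖ t
[a-b]+τ≡τ⊖t {a} t τ refl = begin
  (ℤ.+ a ℤ.- ℤ.+ (a + t)) ℤ.+ ℤ.+ τ ≡⟨ cong (ℤ._+ ℤ.+ τ) (ℤ.[+m]-[+n]≡m⊖n a (a + t)) ⟩
  (a ⊖ (a + t)) ℤ.+ ℤ.+ τ           ≡⟨ cong (λ x → (x ⊖ (a + t)) ℤ.+ ℤ.+ τ) (+-identityʳ a) ⟨
  ((a + 0) ⊖ (a + t)) ℤ.+ ℤ.+ τ     ≡⟨ cong (ℤ._+ ℤ.+ τ) (ℤ.+-cancelˡ-⊖ a 0 t) ⟩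
  (0 ⊖ t) ℤ.+ ℤ.+ τ                 ≡⟨ ℤ.distribˡ-⊖-+-pos τ 0 t ⟩
  τ ⊖ t                             ∎
  where open ≡-Reasoning

-- The semigroup S⁽ⁱʲ⁾(p, τ) = ⟨M, G, G + 1⟩_C, with h0 = p/2 − 1

module Family (h0 τ j i E M G : ℕ) (E-def : E ≡ 3 + suc h0 + τ + j) (M-def : M ≡ 2 + suc h0 * suc E)
              (G+D≡uM : G + suc E ≡ (2 + i) * M) where

  h : ℕ
  h = suc h0

  D : ℕ
  D = suc E

  u : ℕ
  u = 2 + i

  Q : ℕ
  Q = u * h + i

  C : ℕ
  C = Q * M ∸ τ

  S : ℕ → Bool
  S = gen3 M G (suc G) C

  -- Opaque so that the bounded search in inSpan3 is never unfolded during type checking.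
  opaque
    spanned : ℕ → Bool
    spanned = inSpan3 M G (suc G)

    spanned-def : ∀ x → spanned x ≡ inSpan3 M G (suc G) x
    spanned-def x = refl

  E-split : E ≡ suc (τ + j + suc (suc h))
  E-split = trans E-def (rearrange h τ j)
    where
    rearrange : ∀ h τ j → 3 + h + τ + j ≡ suc (τ + j + suc (suc h))
    rearrange = solve-∀

  M-blocks : M ≡ h * E + suc (suc h)
  M-blocks = trans M-def (rearrange h E)
    where
    rearrange : ∀ h E → 2 + h * suc E ≡ h * E + suc (suc h)
    rearrange = solve-∀

  2+h<E : suc (suc h) < E
  2+h<E = subst (suc (suc h) <_) (sym E-split) (s<s (m≤n+m (suc (suc h)) (τ + j)))

  h<E : h < E
  h<E = <-trans (n<1+n h) (<-trans (n<1+n (suc h)) 2+h<E)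

  τ+j<E : τ + j < E
  τ+j<E = subst (τ + j <_) (sym E-split) (s≤s (m≤m+n (τ + j) _))

  1+τ<E : suc τ < E
  1+τ<E = subst (suc τ <_) (sym E-split)
    (s<s (subst (suc τ ≤_) (sym (+-suc (τ + j) (suc h))) (s≤s (≤-trans (m≤m+n τ j) (m≤m+n (τ + j) (suc h))))))

  τ<E : τ < E
  τ<E = ≤-<-trans (m≤m+n τ j) τ+j<E

  0<E : 0 < E
  0<E = ≤-<-trans z≤n τ<E

  2+D≤M : 2 + D ≤ M
  2+D≤M = subst (2 + D ≤_) (sym M-def) (+-monoʳ-≤ 2 (m≤m+n D (h0 * D)))

  D<M : D < M
  D<M = ≤-trans (n≤1+n (suc D)) 2+D≤M

  E<M : E < M
  E<M = <-trans (n<1+n E) D<M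

  τ<M : τ < M
  τ<M = <-trans τ<E E<M

  0<M : 0 < M
  0<M = ≤-<-trans z≤n E<M

  M<G : M < G
  M<G = +-cancelʳ-< D M G (begin-strict
    M + D         <⟨ +-monoʳ-< M D<M ⟩
    M + M         ≤⟨ m≤m+n (M + M) (i * M) ⟩
    M + M + i * M ≡⟨ double-plus i M ⟩
    u * M         ≡⟨ G+D≡uM ⟨
    G + D         ∎)
    where
    open ≤-Reasoning
    double-plus : ∀ i M → M + M + i * M ≡ (2 + i) * M
    double-plus = solve-∀

  0<G : 0 < G
  0<G = <-trans 0<M M<G

  u≤Q : u ≤ Q
  u≤Q = ≤-trans (m≤m*n u h) (m≤m+n (u * h) i)

  0<Q : 0 < Q
  0<Q = ≤-trans (s≤s z≤n) u≤Q

  M≤QM : M ≤ Q * M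
  M≤QM = m≤n*m M Q ⦃ >-nonZero 0<Q ⦄

  C+τ≡QM : C + τ ≡ Q * M
  C+τ≡QM = m∸n+n≡m (≤-trans (<⇒≤ τ<M) M≤QM)

  C+1+τ≡1+QM : C + suc τ ≡ suc (Q * M)
  C+1+τ≡1+QM = trans (+-suc C τ) (cong suc C+τ≡QM)

  1+G<C : suc G < C
  1+G<C = +-cancelʳ-≤ τ (suc (suc G)) C (begin
    suc (suc G) + τ ≡⟨ +-suc (suc G) τ ⟨
    suc G + suc τ   ≡⟨ +-suc G (suc τ) ⟨
    G + suc (suc τ) ≤⟨ +-monoʳ-≤ G (s≤s τ<E) ⟩
    G + D           ≡⟨ G+D≡uM ⟩
    u * M           ≤⟨ *-monoˡ-≤ M u≤Q ⟩
    Q * M           ≡⟨ C+τ≡QM ⟨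
    C + τ           ∎)
    where open ≤-Reasoning

  M<C : M < C
  M<C = <-trans M<G (<-trans (n<1+n G) 1+G<C)

  [1+h]G+D≡[1+Q]M+2 : suc h * G + D ≡ suc Q * M + 2
  [1+h]G+D≡[1+Q]M+2 = +-cancelʳ-≡ (h * D) _ _ (begin
    suc h * G + D + h * D    ≡⟨ regroup h G D ⟩
    suc h * (G + D)          ≡⟨ cong (suc h *_) G+D≡uM ⟩
    suc h * (u * M)          ≡⟨ expand h i M ⟩
    suc Q * M + M            ≡⟨ cong (suc Q * M +_) M-def ⟩
    suc Q * M + (2 + h * D)  ≡⟨ +-assoc (suc Q * M) 2 (h * D) ⟨
    suc Q * M + 2 + h * D    ∎)
    where
    open ≡-Reasoning
    regroup : ∀ h G D → suc h * G + D + h * D ≡ suc h * (G + D)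
    regroup = solve-∀
    expand : ∀ h i M → suc h * ((2 + i) * M) ≡ suc ((2 + i) * h + i) * M + M
    expand = solve-∀

  QM<[1+h]G : Q * M < suc h * G
  QM<[1+h]G = +-cancelʳ-< D (Q * M) (suc h * G) (begin-strict
    Q * M + D      ≤⟨ +-monoʳ-≤ (Q * M) (<⇒≤ D<M) ⟩
    Q * M + M      ≡⟨ +-comm (Q * M) M ⟩
    suc Q * M      <⟨ m<m+n (suc Q * M) z<s ⟩
    suc Q * M + 2  ≡⟨ [1+h]G+D≡[1+Q]M+2 ⟨
    suc h * G + D  ∎)
    where open ≤-Reasoning

  [1+Q]M<[2+h]G : suc Q * M < suc (suc h) * G
  [1+Q]M<[2+h]G = +-cancelʳ-< D (suc Q * M) (suc (suc h) * G) (begin-strict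
    suc Q * M + D      ≤⟨ +-monoʳ-≤ (suc Q * M) (<⇒≤ (<-trans D<M M<G)) ⟩
    suc Q * M + G      <⟨ +-monoˡ-< G (m<m+n (suc Q * M) z<s) ⟩
    suc Q * M + 2 + G  ≡⟨ cong (_+ G) [1+h]G+D≡[1+Q]M+2 ⟨
    suc h * G + D + G  ≡⟨ rotate (suc h * G) D G ⟩
    G + suc h * G + D  ∎)
    where
    open ≤-Reasoning
    rotate : ∀ a b c → a + b + c ≡ c + a + b
    rotate = solve-∀

  -- Levels and offsets

  -- x + kD = ℓM + r with r ≤ k says that x is the sum of ℓ − uk copies of M, k − r copies of G
  -- and r copies of G + 1, because G + D = uM.
  Levelled : ℕ → Set
  Levelled x = ∃[ ℓ ] ∃[ k ] ∃[ r ] (r ≤ k × u * k ≤ ℓ × x + k * D ≡ ℓ * M + r)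

  spanned-elim : ∀ (P : ℕ → Set) → (∀ a y z → P (a * M + y * G + z * suc G)) → ∀ {x} → spanned x ≡ true → P x
  spanned-elim P P-combination {x} x∈ = from-combination (inSpan3-sound M G (suc G) x (trans (sym (spanned-def x)) x∈))
    where
    from-combination : ∃[ a ] ∃[ y ] ∃[ z ] (a * M + y * G + z * suc G ≡ x) → P x
    from-combination (a , y , z , a,y,z↦x) = subst P a,y,z↦x (P-combination a y z)

  combination⇒spanned : ∀ a y z → spanned (a * M + y * G + z * suc G) ≡ true
  combination⇒spanned a y z = trans (spanned-def _) (inSpan3-complete M G (suc G) a y z 0<M 0<G z<s refl)

  combination⇒Levelled : ∀ a y z → Levelled (a * M + y * G + z * suc G)
  combination⇒Levelled a y z = a + u * (y + z) , y + z , z , m≤n+m z y , m≤n+m _ a , levelled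
    where
    open ≡-Reasoning
    regroup : ∀ a y z M G D → a * M + y * G + z * suc G + (y + z) * D ≡ a * M + (y + z) * (G + D) + z
    regroup = solve-∀
    collect : ∀ a y z M u → a * M + (y + z) * (u * M) + z ≡ (a + u * (y + z)) * M + z
    collect = solve-∀
    levelled : a * M + y * G + z * suc G + (y + z) * D ≡ (a + u * (y + z)) * M + z
    levelled = begin
      a * M + y * G + z * suc G + (y + z) * D       ≡⟨ regroup a y z M G D ⟩
      a * M + (y + z) * (G + D) + z                 ≡⟨ cong (λ w → a * M + (y + z) * w + z) G+D≡uM ⟩
      a * M + (y + z) * (u * M) + z                 ≡⟨ collect a y z M u ⟩
      (a + u * (y + z)) * M + z                     ∎

  spanned⇒Levelled : ∀ {x} → spanned x ≡ true → Levelled x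
  spanned⇒Levelled = spanned-elim Levelled combination⇒Levelled

  Levelled⇒spanned : ∀ x → Levelled x → spanned x ≡ true
  Levelled⇒spanned x (ℓ , k , r , r≤k , uk≤ℓ , levelled)
    with y , r+y≡k ← m≤n⇒∃[o]m+o≡n r≤k | a , uk+a≡ℓ ← m≤n⇒∃[o]m+o≡n uk≤ℓ =
    subst (λ w → spanned w ≡ true) (+-cancelʳ-≡ _ _ _ a,y,r↦x) (combination⇒spanned a y r)
    where
    open ≡-Reasoning
    regroup : ∀ a y r M G D → a * M + y * G + r * suc G + (r + y) * D ≡ a * M + (r + y) * (G + D) + r
    regroup = solve-∀
    collect : ∀ a k r M u → a * M + k * (u * M) + r ≡ (u * k + a) * M + r
    collect = solve-∀
    a,y,r↦x : a * M + y * G + r * suc G + k * D ≡ x + k * D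
    a,y,r↦x = begin
      a * M + y * G + r * suc G + k * D        ≡⟨ cong (λ w → a * M + y * G + r * suc G + w * D) r+y≡k ⟨
      a * M + y * G + r * suc G + (r + y) * D  ≡⟨ regroup a y r M G D ⟩
      a * M + (r + y) * (G + D) + r            ≡⟨ cong (λ w → a * M + w * (G + D) + r) r+y≡k ⟩
      a * M + k * (G + D) + r                  ≡⟨ cong (λ w → a * M + k * w + r) G+D≡uM ⟩
      a * M + k * (u * M) + r                  ≡⟨ collect a k r M u ⟩
      (u * k + a) * M + r                      ≡⟨ cong (λ w → w * M + r) uk+a≡ℓ ⟩
      ℓ * M + r                                ≡⟨ levelled ⟨
      x + k * D                                ∎

  k*G≤x : ∀ {x ℓ k r} → u * k ≤ ℓ → x + k * D ≡ ℓ * M + r → k * G ≤ x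
  k*G≤x {x} {ℓ} {k} {r} uk≤ℓ levelled = +-cancelʳ-≤ (k * D) (k * G) x (begin
    k * G + k * D  ≡⟨ *-distribˡ-+ k G D ⟨
    k * (G + D)    ≡⟨ cong (k *_) G+D≡uM ⟩
    k * (u * M)    ≡⟨ swap k u M ⟩
    u * k * M      ≤⟨ *-monoˡ-≤ M uk≤ℓ ⟩
    ℓ * M          ≤⟨ m≤m+n _ r ⟩
    ℓ * M + r      ≡⟨ levelled ⟨
    x + k * D      ∎)
    where
    open ≤-Reasoning
    swap : ∀ k u M → k * (u * M) ≡ u * k * M
    swap = solve-∀

  Levelled-k≤ : ∀ {x ℓ k r} K → x < suc K * G → u * k ≤ ℓ → x + k * D ≡ ℓ * M + r → k ≤ K
  Levelled-k≤ {x} {k = k} K x<[1+K]G uk≤ℓ levelled = ≮⇒≥ λ K<k →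
    <-irrefl refl (<-≤-trans x<[1+K]G (≤-trans (*-monoˡ-≤ G K<k) (k*G≤x {k = k} uk≤ℓ levelled)))

  -- With at most h copies of G and G + 1 the offset kE + s stays below M, which makes level and offset unique.
  Bounded : ℕ → Set
  Bounded x = ∀ {ℓ k r} → r ≤ k → u * k ≤ ℓ → x + k * D ≡ ℓ * M + r → k ≤ h

  Bounded-below : ∀ {x} → x < suc h * G → Bounded x
  Bounded-below x<[1+h]G _ uk≤ℓ levelled = Levelled-k≤ h x<[1+h]G uk≤ℓ levelled

  offset<M : ∀ {k s} → k ≤ h → s ≤ k → k * E + s < M
  offset<M {k} {s} k≤h s≤k = subst (k * E + s <_) (sym M-blocks)
    (+-mono-≤-< (*-monoˡ-≤ E k≤h) (s≤s (≤-trans s≤k (≤-trans k≤h (n≤1+n h)))))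

  Levelled-offset : ∀ {x ℓ e ℓ' k' r'} → x + e ≡ ℓ * M → e < M → k' ≤ h → r' ≤ k' →
                    x + k' * D ≡ ℓ' * M + r' → ℓ ≡ ℓ' × ∃[ s' ] (s' ≤ k' × e ≡ k' * E + s')
  Levelled-offset {x} {ℓ} {e} {ℓ'} {k'} {r'} x+e≡ℓM e<M k'≤h r'≤k' levelled
    with s' , r'+s'≡k' ← m≤n⇒∃[o]m+o≡n r'≤k' = ℓ≡ℓ' , s' , s'≤k' , e≡
    where
    s'≤k' : s' ≤ k'
    s'≤k' = subst (s' ≤_) r'+s'≡k' (m≤n+m s' r')
    shuffle : ∀ x a s r → x + (a + s) + r ≡ x + (r + s + a)
    shuffle = solve-∀
    x+offset≡ℓ'M : x + (k' * E + s') ≡ ℓ' * M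
    x+offset≡ℓ'M = +-cancelʳ-≡ r' _ _ (begin
      x + (k' * E + s') + r'   ≡⟨ shuffle x (k' * E) s' r' ⟩
      x + (r' + s' + k' * E)   ≡⟨ cong (λ w → x + (w + k' * E)) r'+s'≡k' ⟩
      x + (k' + k' * E)        ≡⟨ cong (x +_) (*-suc k' E) ⟨
      x + k' * D               ≡⟨ levelled ⟩
      ℓ' * M + r'              ∎)
      where open ≡-Reasoning
    ℓ≡ℓ' : ℓ ≡ ℓ'
    ℓ≡ℓ' = leastMultiple-unique M x+e≡ℓM x+offset≡ℓ'M e<M (offset<M k'≤h s'≤k')
    e≡ : e ≡ k' * E + s'
    e≡ = +-cancelˡ-≡ x _ _ (trans x+e≡ℓM (trans (cong (_* M) ℓ≡ℓ') (sym x+offset≡ℓ'M)))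

  offset-spanned : ∀ {x ℓ k s} → x + (k * E + s) ≡ ℓ * M → s ≤ k → u * k ≤ ℓ → spanned x ≡ true
  offset-spanned {x} {ℓ} {k} {s} x+offset≡ℓM s≤k uk≤ℓ with r , s+r≡k ← m≤n⇒∃[o]m+o≡n s≤k =
    Levelled⇒spanned x (ℓ , k , r , subst (r ≤_) s+r≡k (m≤n+m r s) , uk≤ℓ , levelled)
    where
    open ≡-Reasoning
    shuffle : ∀ x s r a → x + (s + r + a) ≡ x + (a + s) + r
    shuffle = solve-∀
    levelled : x + k * D ≡ ℓ * M + r
    levelled = begin
      x + k * D            ≡⟨ cong (x +_) (*-suc k E) ⟩
      x + (k + k * E)      ≡⟨ cong (λ w → x + (w + k * E)) s+r≡k ⟨
      x + (s + r + k * E)  ≡⟨ shuffle x s r (k * E) ⟩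
      x + (k * E + s) + r  ≡⟨ cong (_+ r) x+offset≡ℓM ⟩
      ℓ * M + r            ∎

  Levelled-offset-bounds : ∀ {x ℓ k s} → x + (k * E + s) ≡ ℓ * M → k * E + s < M → s < E → Bounded x →
                           Levelled x → s ≤ k × u * k ≤ ℓ
  Levelled-offset-bounds {x} {ℓ} {k} {s} x+offset≡ℓM offset<M s<E bounded (ℓ' , k' , r' , r'≤k' , uk'≤ℓ' , levelled) =
    subst₂ _≤_ (sym s≡s') (sym k≡k') s'≤k' , subst₂ (λ a b → u * a ≤ b) (sym k≡k') (sym ℓ≡ℓ') uk'≤ℓ'
    where
    k'≤h : k' ≤ h
    k'≤h = bounded r'≤k' uk'≤ℓ' levelled
    reading : ℓ ≡ ℓ' × ∃[ s' ] (s' ≤ k' × k * E + s ≡ k' * E + s')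
    reading = Levelled-offset x+offset≡ℓM offset<M k'≤h r'≤k' levelled
    ℓ≡ℓ' : ℓ ≡ ℓ'
    ℓ≡ℓ' = proj₁ reading
    s' : ℕ
    s' = proj₁ (proj₂ reading)
    s'≤k' : s' ≤ k'
    s'≤k' = proj₁ (proj₂ (proj₂ reading))
    offset≡ : k * E + s ≡ k' * E + s'
    offset≡ = proj₂ (proj₂ (proj₂ reading))
    s'<E : s' < E
    s'<E = ≤-<-trans s'≤k' (≤-<-trans k'≤h h<E)
    k≡k' : k ≡ k'
    k≡k' = quotient-unique E k s k' s' offset≡ s<E s'<E
    s≡s' : s ≡ s'
    s≡s' = remainder-unique E k s k' s' offset≡ s<E s'<E

  spanned-offset : ∀ {x ℓ k s} → x + (k * E + s) ≡ ℓ * M → k * E + s < M → s < E → Bounded x →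
                   spanned x ≡ true → s ≤ k × u * k ≤ ℓ
  spanned-offset {x} x+offset≡ℓM offset<M s<E bounded x∈ =
    Levelled-offset-bounds x+offset≡ℓM offset<M s<E bounded (spanned⇒Levelled x∈)

  atLevel : ℕ → ℕ → Bool
  atLevel ℓ e = spanned (ℓ * M ∸ e)

  atLevel-offset : ∀ ℓ {e} → 0 < ℓ → e < M → ℓ * M ∸ e + e ≡ ℓ * M
  atLevel-offset (suc ℓ) _ e<M = m∸n+n≡m (≤-trans (<⇒≤ e<M) (m≤m+n M (ℓ * M)))

  atLevel-criterion : ∀ {ℓ k s} → 0 < ℓ → s < E → k * E + s < M → Bounded (ℓ * M ∸ (k * E + s)) →
                      atLevel ℓ (k * E + s) ≡ (s ≤ᵇ k) ∧ (u * k ≤ᵇ ℓ)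
  atLevel-criterion {ℓ} {k} {s} 0<ℓ s<E offset<M bounded = decide (s ≤? k) (u * k ≤? ℓ)
    where
    at-offset : ℓ * M ∸ (k * E + s) + (k * E + s) ≡ ℓ * M
    at-offset = atLevel-offset ℓ 0<ℓ offset<M
    read : atLevel ℓ (k * E + s) ≡ true → s ≤ k × u * k ≤ ℓ
    read = spanned-offset {ℓ = ℓ} {k} {s} at-offset offset<M s<E bounded
    decide : Dec (s ≤ k) → Dec (u * k ≤ ℓ) → atLevel ℓ (k * E + s) ≡ (s ≤ᵇ k) ∧ (u * k ≤ᵇ ℓ)
    decide (yes s≤k) (yes uk≤ℓ) rewrite ≤⇒≤ᵇ≡true s≤k | ≤⇒≤ᵇ≡true uk≤ℓ = offset-spanned {ℓ = ℓ} {k} {s} at-offset s≤k uk≤ℓ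
    decide (yes s≤k) (no uk≰ℓ) rewrite ≤⇒≤ᵇ≡true s≤k | >⇒≤ᵇ≡false (≰⇒> uk≰ℓ) = ¬-not λ x∈ → uk≰ℓ (proj₂ (read x∈))
    decide (no s≰k) _ rewrite >⇒≤ᵇ≡false (≰⇒> s≰k) = ¬-not λ x∈ → s≰k (proj₁ (read x∈))

  atLevel-0 : ∀ ℓ → 0 < ℓ → atLevel ℓ 0 ≡ true
  atLevel-0 ℓ _ = offset-spanned {k = 0} (+-identityʳ (ℓ * M)) z≤n (subst (_≤ ℓ) (sym (*-zeroʳ u)) z≤n)

  blockCount : ℕ → ℕ → ℕ
  blockCount ℓ k = fromBool (u * k ≤ᵇ ℓ) * suc k

  levelCount : ℕ → ℕ
  levelCount ℓ = sumFrom (blockCount ℓ) 0 (suc h)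

  countBlock : ∀ {ℓ k n} → 0 < ℓ → k < n → n ≤ E → k * E + n ≤ M →
               (∀ s → s < n → Bounded (ℓ * M ∸ (k * E + s))) →
               countBelow (λ s → atLevel ℓ (k * E + s)) n ≡ blockCount ℓ k
  countBlock {ℓ} {k} {n} 0<ℓ k<n n≤E block≤M bounded = begin
    countBelow f n                                                      ≡⟨ cong (countBelow f) n≡1+k+rest ⟩
    countBelow f (suc k + (n ∸ suc k))                                  ≡⟨ countBelow-+ f (suc k) (n ∸ suc k) ⟩
    countBelow f (suc k) + countBelow (λ s → f (suc k + s)) (n ∸ suc k) ≡⟨ cong₂ _+_ (countBelow-const _ (suc k) low)
                                                                                         (countBelow-false (n ∸ suc k) high) ⟩
    fromBool (u * k ≤ᵇ ℓ) * suc k + 0                                   ≡⟨ +-identityʳ _ ⟩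
    blockCount ℓ k                                                      ∎
    where
    open ≡-Reasoning
    f : ℕ → Bool
    f s = atLevel ℓ (k * E + s)
    n≡1+k+rest : n ≡ suc k + (n ∸ suc k)
    n≡1+k+rest = sym (m+[n∸m]≡n k<n)
    criterion : ∀ s → s < n → f s ≡ (s ≤ᵇ k) ∧ (u * k ≤ᵇ ℓ)
    criterion s s<n = atLevel-criterion 0<ℓ (<-≤-trans s<n n≤E)
      (<-≤-trans (+-monoʳ-< (k * E) s<n) block≤M) (bounded s s<n)
    low : ∀ s → s < suc k → f s ≡ (u * k ≤ᵇ ℓ)
    low s s<1+k = trans (criterion s (<-≤-trans s<1+k k<n)) (cong (_∧ (u * k ≤ᵇ ℓ)) (≤⇒≤ᵇ≡true (≤-pred s<1+k)))
    high : ∀ s → s < n ∸ suc k → f (suc k + s) ≡ false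
    high s s<rest = trans (criterion (suc k + s) (subst (suc k + s <_) (sym n≡1+k+rest) (+-monoʳ-< (suc k) s<rest)))
      (cong (_∧ (u * k ≤ᵇ ℓ)) (>⇒≤ᵇ≡false (s≤s (m≤m+n k s))))

  kE+E≤M : ∀ {k} → k < h → k * E + E ≤ M
  kE+E≤M {k} k<h = begin
    k * E + E            ≡⟨ +-comm (k * E) E ⟩
    suc k * E            ≤⟨ *-monoˡ-≤ E k<h ⟩
    h * E                ≤⟨ m≤m+n (h * E) (suc (suc h)) ⟩
    h * E + suc (suc h)  ≡⟨ M-blocks ⟨
    M                    ∎
    where open ≤-Reasoning

  -- Offsets kE + s with k < h fill whole blocks of length E; the last block k = h has length h + 2.
  countBlocks : ∀ {ℓ} k₀ n → k₀ + n ≡ h → 0 < ℓ → (∀ e → k₀ * E ≤ e → e < M → Bounded (ℓ * M ∸ e)) →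
                countBelow (λ y → atLevel ℓ (k₀ * E + y)) (n * E + suc (suc h)) ≡ sumFrom (blockCount ℓ) k₀ (suc n)
  countBlocks {ℓ} k₀ n k₀+n≡h 0<ℓ bounded = begin
    countBelow (λ y → atLevel ℓ (k₀ * E + y)) (n * E + suc (suc h))
      ≡⟨ countBelow-blocks (atLevel ℓ) (blockCount ℓ) E k₀ n (suc (suc h)) fullBlock ⟩
    sumFrom (blockCount ℓ) k₀ n + countBelow (λ y → atLevel ℓ ((k₀ + n) * E + y)) (suc (suc h))
      ≡⟨ cong (sumFrom (blockCount ℓ) k₀ n +_) lastBlock ⟩
    sumFrom (blockCount ℓ) k₀ n + blockCount ℓ (k₀ + n)
      ≡⟨ sumFrom-suc (blockCount ℓ) k₀ n ⟨
    sumFrom (blockCount ℓ) k₀ (suc n) ∎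
    where
    open ≡-Reasoning
    bounded-from : ∀ {k} → k₀ ≤ k → ∀ {s} → k * E + s < M → Bounded (ℓ * M ∸ (k * E + s))
    bounded-from {k} k₀≤k {s} offset<M = bounded _ (≤-trans (*-monoˡ-≤ E k₀≤k) (m≤m+n (k * E) s)) offset<M
    fullBlock : ∀ k → k₀ ≤ k → k < k₀ + n → countBelow (λ y → atLevel ℓ (k * E + y)) E ≡ blockCount ℓ k
    fullBlock k k₀≤k k<k₀+n = countBlock 0<ℓ (<-trans k<h h<E) ≤-refl (kE+E≤M k<h)
      (λ s s<E → bounded-from k₀≤k (<-≤-trans (+-monoʳ-< (k * E) s<E) (kE+E≤M k<h)))
      where
      k<h : k < h
      k<h = subst (k <_) k₀+n≡h k<k₀+n
    lastBlock : countBelow (λ y → atLevel ℓ ((k₀ + n) * E + y)) (suc (suc h)) ≡ blockCount ℓ (k₀ + n)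
    lastBlock = subst (λ k → countBelow (λ y → atLevel ℓ (k * E + y)) (suc (suc h)) ≡ blockCount ℓ k) (sym k₀+n≡h)
      (countBlock 0<ℓ (<-trans (n<1+n h) (n<1+n (suc h))) (<⇒≤ 2+h<E) (≤-reflexive (sym M-blocks))
        (λ s s<2+h → bounded-from (subst (k₀ ≤_) k₀+n≡h (m≤m+n k₀ n))
          (<-≤-trans (+-monoʳ-< (h * E) s<2+h) (≤-reflexive (sym M-blocks)))))

  countLevel : ∀ {ℓ} → 0 < ℓ → ℓ ≤ Q → countBelow (atLevel ℓ) M ≡ levelCount ℓ
  countLevel {ℓ} 0<ℓ ℓ≤Q = trans (cong (countBelow (atLevel ℓ)) M-blocks) (countBlocks 0 h refl 0<ℓ
    (λ e _ _ → Bounded-below (≤-<-trans (m∸n≤m (ℓ * M) e) (≤-<-trans (*-monoˡ-≤ M ℓ≤Q) QM<[1+h]G))))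

  u[1+h]≡2+Q : u * suc h ≡ 2 + Q
  u[1+h]≡2+Q = expand h i
    where
    expand : ∀ h i → (2 + i) * suc h ≡ 2 + ((2 + i) * h + i)
    expand = solve-∀

  -- On level Q + 1 a representation may use h + 1 copies of G and G + 1, but only for
  -- offsets e with r + e + 1 = E.
  Levelled-top : ∀ {x e ℓ' k' r'} → x + e ≡ suc Q * M → r' ≤ k' → u * k' ≤ ℓ' → x + k' * D ≡ ℓ' * M + r' →
                 k' ≤ h ⊎ (r' ≤ suc h × r' + e + 1 ≡ E)
  Levelled-top {x} {e} {ℓ'} {k'} {r'} x+e≡[1+Q]M r'≤k' uk'≤ℓ' levelled
    with m≤n⇒m<n∨m≡n (Levelled-k≤ {k = k'} (suc h)
           (≤-<-trans (subst (x ≤_) x+e≡[1+Q]M (m≤m+n x e)) [1+Q]M<[2+h]G) uk'≤ℓ' levelled)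
  ... | inj₁ k'<1+h = inj₁ (≤-pred k'<1+h)
  ... | inj₂ refl = inj₂ (r'≤k' , r'+e+1≡E)
    where
    a : ℕ
    a = proj₁ (m≤n⇒∃[o]m+o≡n (subst (_≤ ℓ') u[1+h]≡2+Q uk'≤ℓ'))
    2+Q+a≡ℓ' : 2 + Q + a ≡ ℓ'
    2+Q+a≡ℓ' = proj₂ (m≤n⇒∃[o]m+o≡n (subst (_≤ ℓ') u[1+h]≡2+Q uk'≤ℓ'))
    regroup : ∀ Q a M r e → (2 + Q + a) * M + r + e ≡ suc Q * M + (M + a * M + r + e)
    regroup = solve-∀
    rotate : ∀ w b r e → 2 + w + b + r + e ≡ 2 + b + r + e + w
    rotate = solve-∀
    D≡ : D ≡ 2 + a * M + r' + e
    D≡ = +-cancelʳ-≡ (h * D) _ _ (+-cancelˡ-≡ (suc Q * M) _ _ (begin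
      suc Q * M + (D + h * D)                   ≡⟨ cong (_+ (D + h * D)) x+e≡[1+Q]M ⟨
      x + e + (D + h * D)                       ≡⟨ xy∙z≈xz∙y x e (D + h * D) ⟩
      x + suc h * D + e                         ≡⟨ cong (_+ e) levelled ⟩
      ℓ' * M + r' + e                           ≡⟨ cong (λ w → w * M + r' + e) 2+Q+a≡ℓ' ⟨
      (2 + Q + a) * M + r' + e                  ≡⟨ regroup Q a M r' e ⟩
      suc Q * M + (M + a * M + r' + e)          ≡⟨ cong (λ w → suc Q * M + (w + a * M + r' + e)) M-def ⟩
      suc Q * M + (2 + h * D + a * M + r' + e)  ≡⟨ cong (suc Q * M +_) (rotate (h * D) (a * M) r' e) ⟩
      suc Q * M + (2 + a * M + r' + e + h * D)  ∎))
      where open ≡-Reasoning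
    a≡0 : a ≡ 0
    a≡0 with a | D≡
    ... | zero | _ = refl
    ... | suc a' | D≡2+M+a'M+r'+e = contradiction (subst (M ≤_) (sym D≡2+M+a'M+r'+e)
          (≤-trans (m≤m+n M (a' * M)) (≤-trans (m≤n+m _ 2) (≤-trans (m≤m+n _ r') (m≤m+n _ e))))) (<⇒≱ D<M)
    r'+e+1≡E : r' + e + 1 ≡ E
    r'+e+1≡E = trans (+-comm (r' + e) 1) (sym (suc-injective (subst (λ a → D ≡ 2 + a * M + r' + e) a≡0 D≡)))

  Bounded-top : ∀ {x e} → x + e ≡ suc Q * M → (∀ {r} → r ≤ suc h → r + e + 1 ≢ E) → Bounded x
  Bounded-top x+e≡[1+Q]M no-top-rep r≤k uk≤ℓ levelled with Levelled-top x+e≡[1+Q]M r≤k uk≤ℓ levelled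
  ... | inj₁ k≤h = k≤h
  ... | inj₂ (r≤1+h , r+e+1≡E) = contradiction r+e+1≡E (no-top-rep r≤1+h)

  top-offset-spanned : ∀ {x s} → x + s ≡ suc Q * M → τ + j < s → s < E → spanned x ≡ true
  top-offset-spanned {x} {s} x+s≡[1+Q]M τ+j<s s<E with r , 1+s+r≡E ← m≤n⇒∃[o]m+o≡n s<E =
    Levelled⇒spanned x (2 + Q , suc h , r , r≤1+h , ≤-reflexive u[1+h]≡2+Q , levelled)
    where
    open ≡-Reasoning
    r≤1+h : r ≤ suc h
    r≤1+h = +-cancelˡ-≤ (suc (τ + j)) r (suc h)
      (subst (suc (τ + j) + r ≤_) (trans (suc-injective (trans 1+s+r≡E E-split)) (+-suc (τ + j) (suc h)))
             (+-monoˡ-≤ r τ+j<s))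
    shuffle₁ : ∀ x s w D → x + (D + w) + (s + 2) ≡ x + s + (D + (2 + w))
    shuffle₁ = solve-∀
    shuffle₂ : ∀ Q M s r → suc Q * M + (suc (suc s + r) + M) ≡ (2 + Q) * M + r + (s + 2)
    shuffle₂ = solve-∀
    levelled : x + suc h * D ≡ (2 + Q) * M + r
    levelled = +-cancelʳ-≡ (s + 2) _ _ (begin
      x + suc h * D + (s + 2)            ≡⟨ shuffle₁ x s (h * D) D ⟩
      x + s + (D + (2 + h * D))          ≡⟨ cong₂ (λ a b → a + (D + b)) x+s≡[1+Q]M (sym M-def) ⟩
      suc Q * M + (D + M)                ≡⟨ cong (λ w → suc Q * M + (suc w + M)) 1+s+r≡E ⟨
      suc Q * M + (suc (suc s + r) + M)  ≡⟨ shuffle₂ Q M s r ⟩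
      (2 + Q) * M + r + (s + 2)          ∎)

  top-low-offset-not-spanned : ∀ {y} → y < τ + j → atLevel (suc Q) (suc y) ≡ false
  top-low-offset-not-spanned {y} y<τ+j = atLevel-criterion {suc Q} {0} {suc y} z<s 1+y<E (<-trans 1+y<E E<M)
    (Bounded-top (atLevel-offset (suc Q) z<s (<-trans 1+y<E E<M)) λ {r} r≤1+h → <⇒≢ (begin-strict
      r + suc y + 1        ≤⟨ +-monoˡ-≤ 1 (+-mono-≤ r≤1+h y<τ+j) ⟩
      suc h + (τ + j) + 1  <⟨ ≤-reflexive (trans (rearrange h (τ + j)) (sym E-split)) ⟩
      E                    ∎))
    where
    open ≤-Reasoning
    1+y<E : suc y < E
    1+y<E = ≤-<-trans y<τ+j τ+j<E
    rearrange : ∀ h t → suc (suc h + t + 1) ≡ suc (t + suc (suc h))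
    rearrange = solve-∀

  countTopFirstBlock : countBelow (atLevel (suc Q)) E ≡ suc (suc (suc h))
  countTopFirstBlock = begin
    countBelow f E
      ≡⟨ cong (countBelow f) E-split ⟩
    fromBool (f 0) + countBelow (λ y → f (suc y)) (τ + j + suc (suc h))
      ≡⟨ cong (fromBool (f 0) +_) (countBelow-+ (λ y → f (suc y)) (τ + j) (suc (suc h))) ⟩
    fromBool (f 0) + (countBelow (λ y → f (suc y)) (τ + j) + countBelow (λ y → f (suc (τ + j + y))) (suc (suc h)))
      ≡⟨ cong₂ _+_ (cong fromBool (atLevel-0 (suc Q) z<s))
           (cong₂ _+_ (countBelow-false (τ + j) (λ y → top-low-offset-not-spanned))
                      (countBelow-true (suc (suc h)) high)) ⟩
    suc (suc (suc h)) ∎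
    where
    open ≡-Reasoning
    f : ℕ → Bool
    f = atLevel (suc Q)
    high : ∀ y → y < suc (suc h) → f (suc (τ + j + y)) ≡ true
    high y y<2+h = top-offset-spanned (atLevel-offset (suc Q) z<s (<-trans s<E E<M)) (s≤s (m≤m+n (τ + j) y)) s<E
      where
      s<E : suc (τ + j + y) < E
      s<E = subst (suc (τ + j + y) <_) (sym E-split) (s<s (+-monoʳ-< (τ + j) y<2+h))

  topLevelCount : ℕ
  topLevelCount = suc (suc (suc h)) + sumFrom (blockCount (suc Q)) 1 h

  countTopLevel : countBelow (atLevel (suc Q)) M ≡ topLevelCount
  countTopLevel = begin
    countBelow f M                                                        ≡⟨ cong (countBelow f) M≡E+rest ⟩
    countBelow f (E + (h0 * E + suc (suc h)))                             ≡⟨ countBelow-+ f E _ ⟩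
    countBelow f E + countBelow (λ y → f (E + y)) (h0 * E + suc (suc h))  ≡⟨ cong₂ _+_ countTopFirstBlock rest ⟩
    topLevelCount                                                         ∎
    where
    open ≡-Reasoning
    f : ℕ → Bool
    f = atLevel (suc Q)
    M≡E+rest : M ≡ E + (h0 * E + suc (suc h))
    M≡E+rest = trans M-blocks (+-assoc E (h0 * E) _)
    bounded : ∀ e → 1 * E ≤ e → e < M → Bounded (suc Q * M ∸ e)
    bounded e 1E≤e e<M = Bounded-top (atLevel-offset (suc Q) z<s e<M) λ {r} _ →
      >⇒≢ (≤-trans (s≤s (subst (_≤ e) (*-identityˡ E) 1E≤e))
                   (≤-trans (≤-reflexive (+-comm 1 e)) (+-monoˡ-≤ 1 (m≤n+m e r))))
    rest : countBelow (λ y → f (E + y)) (h0 * E + suc (suc h)) ≡ sumFrom (blockCount (suc Q)) 1 h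
    rest = trans (countBelow-cong (h0 * E + suc (suc h)) (λ y _ → cong (λ w → f (w + y)) (sym (+-identityʳ E))))
                 (countBlocks 1 h0 refl z<s bounded)

  -- Conductor, multiplicity and |L|

  S-below : ∀ {x} → x < C → S x ≡ spanned x
  S-below {x} x<C = trans (cong (_∨ inSpan3 M G (suc G) x) (>⇒≤ᵇ≡false x<C)) (sym (spanned-def x))

  S-above : ∀ {x} → C ≤ x → S x ≡ true
  S-above {x} C≤x = cong (_∨ inSpan3 M G (suc G) x) (≤⇒≤ᵇ≡true C≤x)

  spanned⇒S : ∀ {x} → spanned x ≡ true → S x ≡ true
  spanned⇒S {x} x∈ = trans (cong ((C ≤ᵇ x) ∨_) (trans (sym (spanned-def x)) x∈)) (∨-zeroʳ _)

  S⇒spanned : ∀ {x} → x < M → S x ≡ true → spanned x ≡ true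
  S⇒spanned x<M x∈S = trans (sym (S-below (<-trans x<M M<C))) x∈S

  spanned-0 : spanned 0 ≡ true
  spanned-0 = Levelled⇒spanned 0 (0 , 0 , 0 , z≤n , ≤-reflexive (*-zeroʳ u) , refl)

  level-Q-offset-not-spanned : ∀ {y} → suc y < E → atLevel Q (suc y) ≡ false
  level-Q-offset-not-spanned {y} 1+y<E = atLevel-criterion {Q} {0} {suc y} 0<Q 1+y<E (<-trans 1+y<E E<M)
    (Bounded-below (≤-<-trans (m∸n≤m (Q * M) (suc y)) QM<[1+h]G))

  countUpToLevel : ∀ ℓ → ℓ ≤ Q → countBelow spanned (suc (ℓ * M)) ≡ 1 + sumFrom levelCount 1 ℓ
  countUpToLevel zero _ = cong (λ b → fromBool b + 0) spanned-0
  countUpToLevel (suc ℓ) 1+ℓ≤Q = begin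
    countBelow spanned (suc (M + ℓ * M))
      ≡⟨ cong (λ n → countBelow spanned (suc n)) (+-comm M (ℓ * M)) ⟩
    countBelow spanned (suc (ℓ * M) + M)
      ≡⟨ countBelow-+ spanned (suc (ℓ * M)) M ⟩
    countBelow spanned (suc (ℓ * M)) + countBelow (λ y → spanned (suc (ℓ * M) + y)) M
      ≡⟨ cong₂ _+_ (countUpToLevel ℓ (<⇒≤ 1+ℓ≤Q))
           (trans (countBelow-reflect spanned (suc (ℓ * M)) M (suc ℓ * M) (cong suc (+-comm (ℓ * M) M)))
                  (countLevel z<s 1+ℓ≤Q)) ⟩
    1 + sumFrom levelCount 1 ℓ + levelCount (suc ℓ)
      ≡⟨ +-assoc 1 (sumFrom levelCount 1 ℓ) (levelCount (suc ℓ)) ⟩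
    1 + (sumFrom levelCount 1 ℓ + levelCount (1 + ℓ))
      ≡⟨ cong (1 +_) (sumFrom-suc levelCount 1 ℓ) ⟨
    1 + sumFrom levelCount 1 (suc ℓ) ∎
    where open ≡-Reasoning

  countFromC : countBelow (λ y → spanned (C + y)) (suc τ) ≡ 1
  countFromC = begin
    countBelow (λ y → spanned (C + y)) (suc τ)          ≡⟨ countBelow-reflect spanned C (suc τ) (Q * M) C+1+τ≡1+QM ⟩
    fromBool (atLevel Q 0) + countBelow (λ y → atLevel Q (suc y)) τ
      ≡⟨ cong₂ _+_ (cong fromBool (atLevel-0 Q 0<Q))
                   (countBelow-false τ (λ y y<τ → level-Q-offset-not-spanned (≤-<-trans y<τ τ<E))) ⟩
    1                                                   ∎
    where open ≡-Reasoning

  count-L : countBelow S C ≡ sumFrom levelCount 1 Q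
  count-L = +-cancelʳ-≡ 1 _ _ (begin
    countBelow S C + 1
      ≡⟨ cong₂ _+_ (countBelow-cong C (λ _ x<C → sym (S-below x<C))) countFromC ⟨
    countBelow spanned C + countBelow (λ y → spanned (C + y)) (suc τ) ≡⟨ countBelow-+ spanned C (suc τ) ⟨
    countBelow spanned (C + suc τ)                                   ≡⟨ cong (countBelow spanned) C+1+τ≡1+QM ⟩
    countBelow spanned (suc (Q * M))                                 ≡⟨ countUpToLevel Q ≤-refl ⟩
    1 + sumFrom levelCount 1 Q                                       ≡⟨ +-comm 1 _ ⟩
    sumFrom levelCount 1 Q + 1                                       ∎)
    where open ≡-Reasoning

  C≡1+[QM∸1+τ] : C ≡ suc (Q * M ∸ suc τ)
  C≡1+[QM∸1+τ] = m∸n≡1+[m∸1+n] (<-≤-trans τ<M M≤QM)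

  conductor≡C : conductorFrom S C ≡ C
  conductor≡C = begin
    conductorFrom S C
      ≡⟨ cong (conductorFrom S) C≡1+[QM∸1+τ] ⟩
    (if S (Q * M ∸ suc τ) then conductorFrom S (Q * M ∸ suc τ) else suc (Q * M ∸ suc τ))
      ≡⟨ cong (λ b → if b then conductorFrom S (Q * M ∸ suc τ) else suc (Q * M ∸ suc τ)) S[C-1]≡false ⟩
    suc (Q * M ∸ suc τ)
      ≡⟨ C≡1+[QM∸1+τ] ⟨
    C ∎
    where
    open ≡-Reasoning
    S[C-1]≡false : S (Q * M ∸ suc τ) ≡ false
    S[C-1]≡false = trans (S-below (subst (Q * M ∸ suc τ <_) (sym C≡1+[QM∸1+τ]) ≤-refl))
                         (level-Q-offset-not-spanned 1+τ<E)

  M≤combination : ∀ a y z → 0 < a * M + y * G + z * suc G → M ≤ a * M + y * G + z * suc G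
  M≤combination (suc a) y z _ = ≤-trans (m≤m+n M (a * M)) (≤-trans (m≤m+n _ (y * G)) (m≤m+n _ (z * suc G)))
  M≤combination zero (suc y) z _ = ≤-trans (<⇒≤ M<G) (≤-trans (m≤m+n G (y * G)) (m≤m+n _ (z * suc G)))
  M≤combination zero zero (suc z) _ = ≤-trans (<⇒≤ M<G) (≤-trans (n≤1+n G) (m≤m+n (suc G) (z * suc G)))
  M≤combination zero zero zero ()

  M≤spanned : ∀ {x} → spanned x ≡ true → 0 < x → M ≤ x
  M≤spanned = spanned-elim (λ x → 0 < x → M ≤ x) M≤combination

  spanned-M : spanned M ≡ true
  spanned-M = subst (λ w → spanned w ≡ true) (trans (+-identityʳ _) (trans (+-identityʳ _) (+-identityʳ M)))
                    (combination⇒spanned 1 0 0)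

  multiplicity≡M : multiplicityFrom S C ≡ M
  multiplicity≡M = firstFrom-≡ S 1 C M 0<M (<⇒≤ (<-trans M<C (n<1+n C)))
    (λ x 0<x x<M → ¬-not λ x∈S → <⇒≱ x<M (M≤spanned (S⇒spanned x<M x∈S) 0<x))
    (spanned⇒S spanned-M)

  ceilDiv≡Q : ceilDiv C M ≡ Q
  ceilDiv≡Q = trans (cong (ceilDiv C) M-def)
    (ceilDiv-≡ C (suc (h * D)) Q τ (trans C+τ≡QM (cong (Q *_) M-def)) (≤-pred (subst (τ <_) M-def τ<M)))

  ρ≡τ : Q * M ∸ C ≡ τ
  ρ≡τ = m∸[m∸n]≡n (≤-trans (<⇒≤ τ<M) M≤QM)

  -- Minimal generators and D_q

  spanned-+ : ∀ {x x'} → spanned x ≡ true → spanned x' ≡ true → spanned (x + x') ≡ true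
  spanned-+ {x' = x'} x∈ x'∈ = spanned-elim (λ x → spanned (x + x') ≡ true)
    (λ a y z → spanned-elim (λ x' → spanned (a * M + y * G + z * suc G + x') ≡ true)
      (λ a' y' z' → subst (λ w → spanned w ≡ true) (merge a y z a' y' z' M G) (combination⇒spanned (a + a') (y + y') (z + z')))
      x'∈)
    x∈
    where
    merge : ∀ a y z a' y' z' M G → (a + a') * M + (y + y') * G + (z + z') * suc G
                                 ≡ (a * M + y * G + z * suc G) + (a' * M + y' * G + z' * suc G)
    merge = solve-∀

  combination<G⇒multiple : ∀ a y z → a * M + y * G + z * suc G < G → ∃[ n ] (a * M + y * G + z * suc G ≡ n * M)
  combination<G⇒multiple a zero zero _ = a , trans (+-identityʳ _) (+-identityʳ _)
  combination<G⇒multiple a (suc y) z x<G = contradiction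
    (≤-trans (m≤n+m G (a * M)) (≤-trans (+-monoʳ-≤ (a * M) (m≤m+n G (y * G))) (m≤m+n _ (z * suc G)))) (<⇒≱ x<G)
  combination<G⇒multiple a zero (suc z) x<G = contradiction
    (≤-trans (n≤1+n G) (≤-trans (m≤n+m (suc G) (a * M + 0)) (+-monoʳ-≤ (a * M + 0) (m≤m+n (suc G) (z * suc G)))))
    (<⇒≱ x<G)

  spanned<G⇒multiple : ∀ {x} → spanned x ≡ true → x < G → ∃[ n ] (x ≡ n * M)
  spanned<G⇒multiple = spanned-elim (λ x → x < G → ∃[ n ] (x ≡ n * M)) combination<G⇒multiple

  data Generator : ℕ → Set where
    gen-M : Generator M
    gen-G : Generator G
    gen-1+G : Generator (suc G)

  generator-spanned : ∀ {g} → Generator g → spanned g ≡ true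
  generator-spanned gen-M = spanned-M
  generator-spanned gen-G =
    subst (λ w → spanned w ≡ true) (trans (+-identityʳ (G + 0)) (+-identityʳ G)) (combination⇒spanned 0 1 0)
  generator-spanned gen-1+G = subst (λ w → spanned w ≡ true) (+-identityʳ (suc G)) (combination⇒spanned 0 0 1)

  generator≤1+G : ∀ {g} → Generator g → g ≤ suc G
  generator≤1+G gen-M = ≤-trans (<⇒≤ M<G) (n≤1+n G)
  generator≤1+G gen-G = n≤1+n G
  generator≤1+G gen-1+G = ≤-refl

  generator-positive : ∀ {g} → Generator g → 0 < g
  generator-positive gen-M = 0<M
  generator-positive gen-G = 0<G
  generator-positive gen-1+G = z<s

  remove : ∀ g w {x} → x ≡ g + w → spanned w ≡ true → g ≤ x × spanned (x ∸ g) ≡ true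
  remove g w refl w∈ = m≤m+n g w , subst (λ v → spanned v ≡ true) (sym (m+n∸m≡n g w)) w∈

  decompose-combination : ∀ a y z → 0 < a * M + y * G + z * suc G →
    ∃[ g ] (Generator g × g ≤ a * M + y * G + z * suc G × spanned (a * M + y * G + z * suc G ∸ g) ≡ true)
  decompose-combination (suc a) y z _ =
    M , gen-M , remove M (a * M + y * G + z * suc G) (shuffle M (a * M) (y * G) (z * suc G)) (combination⇒spanned a y z)
    where
    shuffle : ∀ p q r t → p + q + r + t ≡ p + (q + r + t)
    shuffle = solve-∀
  decompose-combination zero (suc y) z _ =
    G , gen-G , remove G (y * G + z * suc G) (+-assoc G (y * G) (z * suc G)) (combination⇒spanned 0 y z)
  decompose-combination zero zero (suc z) _ = suc G , gen-1+G , remove (suc G) (z * suc G) refl (combination⇒spanned 0 0 z)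
  decompose-combination zero zero zero ()

  spanned-decompose : ∀ {x} → spanned x ≡ true → 0 < x → ∃[ g ] (Generator g × g ≤ x × spanned (x ∸ g) ≡ true)
  spanned-decompose =
    spanned-elim (λ x → 0 < x → ∃[ g ] (Generator g × g ≤ x × spanned (x ∸ g) ≡ true)) decompose-combination

  decomposable : ℕ → Bool
  decomposable x = any (λ a → (1 ≤ᵇ a) ∧ S a ∧ S (x ∸ a)) (upTo x)

  decomposable-intro : ∀ {x} a → a < x → 0 < a → S a ≡ true → S (x ∸ a) ≡ true → decomposable x ≡ true
  decomposable-intro a a<x 0<a a∈S rest∈S =
    any-upTo⁺ _ a a<x (cong₂ _∧_ (≤⇒≤ᵇ≡true 0<a) (cong₂ _∧_ a∈S rest∈S))

  decomposable-elim : ∀ {x} → decomposable x ≡ true → ∃[ a ] (a < x × 0 < a × S a ≡ true × S (x ∸ a) ≡ true)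
  decomposable-elim {x} decomp with a , a<x , witness ← any-upTo⁻ _ x decomp
    with (1 ≤ᵇ a) in 0<ᵇa | S a in a∈S | S (x ∸ a) in rest∈S
  ... | true | true | true = a , a<x , ≤ᵇ≡true⇒≤ 1 a 0<ᵇa , a∈S , rest∈S
  ... | true | true | false = contradiction witness λ ()
  ... | true | false | _ = contradiction witness λ ()
  ... | false | _ | _ = contradiction witness λ ()

  decomposable-via-generator : ∀ {x g} → Generator g → g ≤ x → spanned (x ∸ g) ≡ true → g ≢ x → decomposable x ≡ true
  decomposable-via-generator gen g≤x rest∈ g≢x =
    decomposable-intro _ (≤∧≢⇒< g≤x g≢x) (generator-positive gen) (spanned⇒S (generator-spanned gen)) (spanned⇒S rest∈)

  no-element-below-M : ∀ {x} → x < M → S x ≡ true → 0 < x → ⊥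
  no-element-below-M x<M x∈S 0<x = <⇒≱ x<M (M≤spanned (S⇒spanned x<M x∈S) 0<x)

  decomposable-above-C : ∀ {x} → C ≤ x → x < C + M → decomposable x ≡ spanned x
  decomposable-above-C {x} C≤x x<C+M = ⇔→≡ (mk⇔ sum-of-parts split-off-generator)
    where
    split-off-generator : spanned x ≡ true → decomposable x ≡ true
    split-off-generator x∈ = split (spanned-decompose x∈ (<-≤-trans 0<M (<⇒≤ (<-≤-trans M<C C≤x))))
      where
      split : ∃[ g ] (Generator g × g ≤ x × spanned (x ∸ g) ≡ true) → decomposable x ≡ true
      split (g , gen , g≤x , rest∈) =
        decomposable-via-generator gen g≤x rest∈ (<⇒≢ (≤-<-trans (generator≤1+G gen) (<-≤-trans 1+G<C C≤x)))
    -- If one part were at least C, the other would be a nonzero element of S below M.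
    sum-of-parts : decomposable x ≡ true → spanned x ≡ true
    sum-of-parts decomp with a , a<x , 0<a , a∈S , b∈S ← decomposable-elim decomp =
      subst (λ w → spanned w ≡ true) a+b≡x (spanned-+ (part-spanned a<C a∈S) (part-spanned b<C b∈S))
      where
      b : ℕ
      b = x ∸ a
      a+b≡x : a + b ≡ x
      a+b≡x = m+[n∸m]≡n (<⇒≤ a<x)
      part-spanned : ∀ {c} → c < C → S c ≡ true → spanned c ≡ true
      part-spanned c<C c∈S = trans (sym (S-below c<C)) c∈S
      part<C : ∀ {c d} → c + d ≡ x → 0 < d → S d ≡ true → c < C
      part<C {c} {d} c+d≡x 0<d d∈S = ≰⇒> λ C≤c → no-element-below-M (d<M C≤c) d∈S 0<d
        where
        d<M : C ≤ c → d < M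
        d<M C≤c = +-cancelˡ-< c d M (begin-strict
          c + d  ≡⟨ c+d≡x ⟩
          x      <⟨ x<C+M ⟩
          C + M  ≤⟨ +-monoˡ-≤ M C≤c ⟩
          c + M  ∎)
          where open ≤-Reasoning
      a<C : a < C
      a<C = part<C a+b≡x (m<n⇒0<n∸m a<x) b∈S
      b<C : b < C
      b<C = part<C (trans (+-comm b a) a+b≡x) 0<a a∈S

  notMinGen-above-C : ∀ t → t < M → not (isMinGen S (C + t)) ≡ spanned (C + t)
  notMinGen-above-C t t<M = begin
    not ((1 ≤ᵇ C + t) ∧ S (C + t) ∧ not (decomposable (C + t)))
      ≡⟨ cong₂ (λ b c → not (b ∧ c ∧ not (decomposable (C + t))))
               (≤⇒≤ᵇ≡true (<-≤-trans 0<C C≤C+t)) (S-above C≤C+t) ⟩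
    not (not (decomposable (C + t)))
      ≡⟨ not-involutive (decomposable (C + t)) ⟩
    decomposable (C + t)
      ≡⟨ decomposable-above-C C≤C+t (+-monoʳ-< C t<M) ⟩
    spanned (C + t) ∎
    where
    open ≡-Reasoning
    0<C : 0 < C
    0<C = <-trans 0<M M<C
    C≤C+t : C ≤ C + t
    C≤C+t = m≤m+n C t

  -- The generators are indecomposable: a decomposition of a generator g ≤ G + 1 would have two
  -- nonzero parts in S below C, hence both multiples of M, so g would be a multiple of M; but
  -- G = uM − D and G + 1 = uM − E with 0 < E < D < M.
  generator-indecomposable : ∀ {g} → Generator g → decomposable g ≡ false
  generator-indecomposable {g} gen = ¬-not λ decomp → no-decomposition (decomposable-elim decomp)
    where
    g<C : g < C
    g<C = ≤-<-trans (generator≤1+G gen) 1+G<C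
    part-spanned : ∀ {c} → c ≤ g → S c ≡ true → spanned c ≡ true
    part-spanned c≤g c∈S = trans (sym (S-below (≤-<-trans c≤g g<C))) c∈S
    not-multiple : ∀ {n v d} → n * M + d ≡ v * M → 0 < d → d < M → ⊥
    not-multiple {n} {v} {d} n*M+d≡v*M 0<d d<M =
      <⇒≢ 0<d (sym (remainder-unique M n d v 0 (trans n*M+d≡v*M (sym (+-identityʳ _))) d<M 0<M))
    no-decomposition : ∃[ a ] (a < g × 0 < a × S a ≡ true × S (g ∸ a) ≡ true) → ⊥
    no-decomposition (a , a<g , 0<a , a∈S , b∈S) = multiple-of-M gen
      where
      b : ℕ
      b = g ∸ a
      a∈ : spanned a ≡ true
      a∈ = part-spanned (<⇒≤ a<g) a∈S
      b∈ : spanned b ≡ true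
      b∈ = part-spanned (m∸n≤m g a) b∈S
      a+b≡g : a + b ≡ g
      a+b≡g = m+[n∸m]≡n (<⇒≤ a<g)
      part<G : ∀ {c d} → c + d ≡ g → spanned d ≡ true → 0 < d → c < G
      part<G {c} {d} c+d≡g d∈ 0<d = +-cancelʳ-< 2 c G (begin-strict
        c + 2   ≤⟨ +-monoʳ-≤ c (≤-trans (≤-trans (m≤m+n 2 D) 2+D≤M) (M≤spanned d∈ 0<d)) ⟩
        c + d   ≡⟨ c+d≡g ⟩
        g       ≤⟨ generator≤1+G gen ⟩
        suc G   <⟨ ≤-reflexive (+-comm 2 G) ⟩
        G + 2   ∎)
        where open ≤-Reasoning
      na : ∃[ n ] (a ≡ n * M)
      na = spanned<G⇒multiple a∈ (part<G a+b≡g b∈ (m<n⇒0<n∸m a<g))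
      nb : ∃[ n ] (b ≡ n * M)
      nb = spanned<G⇒multiple b∈ (part<G (trans (+-comm b a) a+b≡g) a∈ 0<a)
      g≡nM : g ≡ (proj₁ na + proj₁ nb) * M
      g≡nM = trans (sym a+b≡g) (trans (cong₂ _+_ (proj₂ na) (proj₂ nb)) (sym (*-distribʳ-+ M (proj₁ na) (proj₁ nb))))
      multiple-of-M : Generator g → ⊥
      multiple-of-M gen-M = <-irrefl refl (<-≤-trans a<g (M≤spanned a∈ 0<a))
      multiple-of-M gen-G = not-multiple {proj₁ na + proj₁ nb} {u} (trans (cong (_+ D) (sym g≡nM)) G+D≡uM) z<s D<M
      multiple-of-M gen-1+G =
        not-multiple {proj₁ na + proj₁ nb} {u} (trans (cong (_+ E) (sym g≡nM)) (trans (sym (+-suc G E)) G+D≡uM)) 0<E E<M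

  generator-minGen : ∀ {g} → Generator g → isMinGen S g ≡ true
  generator-minGen gen = cong₂ _∧_ (≤⇒≤ᵇ≡true (generator-positive gen))
    (cong₂ _∧_ (spanned⇒S (generator-spanned gen)) (cong not (generator-indecomposable gen)))

  nonGenerator-notMinGen : ∀ {x} → x < C → x ≢ M → x ≢ G → x ≢ suc G → isMinGen S x ≡ false
  nonGenerator-notMinGen {zero} _ _ _ _ = refl
  nonGenerator-notMinGen {suc x} x<C x≢M x≢G x≢1+G = by-membership (spanned (suc x)) refl
    where
    ≢-generator : ∀ {g} → Generator g → g ≢ suc x
    ≢-generator gen-M = x≢M ∘ sym
    ≢-generator gen-G = x≢G ∘ sym
    ≢-generator gen-1+G = x≢1+G ∘ sym
    split : ∃[ g ] (Generator g × g ≤ suc x × spanned (suc x ∸ g) ≡ true) → isMinGen S (suc x) ≡ false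
    split (g , gen , g≤x , rest∈) =
      trans (cong (λ d → (1 ≤ᵇ suc x) ∧ S (suc x) ∧ not d) (decomposable-via-generator gen g≤x rest∈ (≢-generator gen)))
            (trans (cong ((1 ≤ᵇ suc x) ∧_) (∧-zeroʳ (S (suc x)))) (∧-zeroʳ (1 ≤ᵇ suc x)))
    by-membership : ∀ b → spanned (suc x) ≡ b → isMinGen S (suc x) ≡ false
    by-membership false x∉ = trans (cong (λ c → (1 ≤ᵇ suc x) ∧ c ∧ not (decomposable (suc x))) (trans (S-below x<C) x∉))
                                   (∧-zeroʳ (1 ≤ᵇ suc x))
    by-membership true x∈ = split (spanned-decompose x∈ z<s)

  count-PL : countBelow (isMinGen S) C ≡ 3
  count-PL = begin
    countBelow f C
      ≡⟨ cong (countBelow f) C≡ ⟨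
    countBelow f (suc M + (G ∸ M) + (C ∸ suc G))
      ≡⟨ countBelow-+ f (suc M + (G ∸ M)) (C ∸ suc G) ⟩
    countBelow f (suc M + (G ∸ M)) + countBelow (λ y → f (suc M + (G ∸ M) + y)) (C ∸ suc G)
      ≡⟨ cong (_+ countBelow (λ y → f (suc M + (G ∸ M) + y)) (C ∸ suc G)) (countBelow-+ f (suc M) (G ∸ M)) ⟩
    countBelow f (suc M) + countBelow (λ y → f (suc M + y)) (G ∸ M) + countBelow (λ y → f (suc M + (G ∸ M) + y)) (C ∸ suc G)
      ≡⟨ cong₂ _+_ (cong₂ _+_ up-to-M up-to-G) up-to-C ⟩
    3 ∎
    where
    open ≡-Reasoning
    f : ℕ → Bool
    f = isMinGen S
    1+M+[G∸M]≡1+G : suc M + (G ∸ M) ≡ suc G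
    1+M+[G∸M]≡1+G = cong suc (m+[n∸m]≡n (<⇒≤ M<G))
    C≡ : suc M + (G ∸ M) + (C ∸ suc G) ≡ C
    C≡ = trans (cong (_+ (C ∸ suc G)) 1+M+[G∸M]≡1+G) (m+[n∸m]≡n (<⇒≤ 1+G<C))
    up-to-M : countBelow f (suc M) ≡ 1
    up-to-M = countBelow-single f M ≤-refl (generator-minGen gen-M) λ x x≤M x≢M →
      let x<M = ≤∧≢⇒< (≤-pred x≤M) x≢M in
      nonGenerator-notMinGen (<-trans x<M M<C) x≢M (<⇒≢ (<-trans x<M M<G)) (<⇒≢ (<-trans x<M (<-trans M<G (n<1+n G))))
    up-to-G : countBelow (λ y → f (suc M + y)) (G ∸ M) ≡ 1
    up-to-G = countBelow-single _ (G ∸ suc M) G∸1+M<G∸M (trans (cong f (m+[n∸m]≡n M<G)) (generator-minGen gen-G))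
      λ y y<G∸M y≢ →
      let 1+M+y<1+G = subst (suc M + y <_) 1+M+[G∸M]≡1+G (+-monoʳ-< (suc M) y<G∸M) in
      nonGenerator-notMinGen (<-trans 1+M+y<1+G 1+G<C) (>⇒≢ (s≤s (m≤m+n M y)))
        (λ 1+M+y≡G → y≢ (+-cancelˡ-≡ (suc M) y (G ∸ suc M) (trans 1+M+y≡G (sym (m+[n∸m]≡n M<G)))))
        (<⇒≢ 1+M+y<1+G)
      where
      G∸1+M<G∸M : G ∸ suc M < G ∸ M
      G∸1+M<G∸M = subst (G ∸ suc M <_) (sym (m∸n≡1+[m∸1+n] M<G)) (n<1+n (G ∸ suc M))
    up-to-C : countBelow (λ y → f (suc M + (G ∸ M) + y)) (C ∸ suc G) ≡ 1
    up-to-C = trans (countBelow-cong (C ∸ suc G) (λ y _ → cong (λ w → f (w + y)) 1+M+[G∸M]≡1+G))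
      (countBelow-single _ 0 (m<n⇒0<n∸m 1+G<C) (trans (cong f (+-identityʳ (suc G))) (generator-minGen gen-1+G))
        λ y y<C∸1+G y≢0 →
        nonGenerator-notMinGen (subst (suc G + y <_) (m+[n∸m]≡n (<⇒≤ 1+G<C)) (+-monoʳ-< (suc G) y<C∸1+G))
          (>⇒≢ (<-≤-trans (<-trans M<G (n<1+n G)) (m≤m+n (suc G) y)))
          (>⇒≢ (≤-trans (n<1+n G) (m≤m+n (suc G) y)))
          (λ 1+G+y≡1+G → y≢0 (+-cancelˡ-≡ (suc G) y 0 (trans 1+G+y≡1+G (sym (+-identityʳ (suc G)))))))

  -- Sliding the window [C, C + M) up by τ + 1 trades its only element QM of [C, QM] for the only
  -- element (Q + 1)M of [C + M, (Q + 1)M], and the slid window is level Q + 1.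
  count-Dq : countBelow (λ t → not (isMinGen S (C + t))) M ≡ topLevelCount
  count-Dq = +-cancelʳ-≡ 1 _ _ (begin
    countBelow (λ t → not (isMinGen S (C + t))) M + 1
      ≡⟨ cong₂ _+_ (countBelow-cong M notMinGen-above-C) (sym countTopLow) ⟩
    countBelow (λ t → spanned (C + t)) M + countBelow (atLevel (suc Q)) (suc τ)
      ≡⟨ cong (countBelow (λ t → spanned (C + t)) M +_)
              (countBelow-reflect spanned (C + M) (suc τ) (suc Q * M) C+M+1+τ≡1+[1+Q]M) ⟨
    countBelow (λ t → spanned (C + t)) M + countBelow (λ t → spanned (C + M + t)) (suc τ)
      ≡⟨ countBelow-slide spanned C M (suc τ) ⟩
    countBelow (λ t → spanned (C + t)) (suc τ) + countBelow (λ t → spanned (C + suc τ + t)) M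
      ≡⟨ cong₂ _+_ countFromC (countBelow-cong M (λ t _ → cong (λ w → spanned (w + t)) C+1+τ≡1+QM)) ⟩
    1 + countBelow (λ t → spanned (suc (Q * M) + t)) M
      ≡⟨ cong (1 +_) (countBelow-reflect spanned (suc (Q * M)) M (suc Q * M) (cong suc (+-comm (Q * M) M))) ⟩
    1 + countBelow (atLevel (suc Q)) M
      ≡⟨ cong (1 +_) countTopLevel ⟩
    1 + topLevelCount
      ≡⟨ +-comm 1 topLevelCount ⟩
    topLevelCount + 1 ∎)
    where
    open ≡-Reasoning
    C+M+1+τ≡1+[1+Q]M : C + M + suc τ ≡ suc (suc Q * M)
    C+M+1+τ≡1+[1+Q]M = trans (xy∙z≈xz∙y C M (suc τ)) (trans (cong (_+ M) C+1+τ≡1+QM) (cong suc (+-comm (Q * M) M)))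
    countTopLow : countBelow (atLevel (suc Q)) (suc τ) ≡ 1
    countTopLow = cong₂ _+_ (cong fromBool (atLevel-0 (suc Q) z<s))
      (countBelow-false τ (λ y y<τ → top-low-offset-not-spanned (≤-trans y<τ (m≤m+n τ j))))

  levelsAbove : ℕ → ℕ
  levelsAbove a = sumFrom (λ ℓ → fromBool (a ≤ᵇ ℓ)) 1 Q

  count-L-by-blocks : sumFrom levelCount 1 Q ≡ Q + sumFrom (λ k → levelsAbove (u * k) * suc k) 1 h
  count-L-by-blocks = begin
    sumFrom levelCount 1 Q
      ≡⟨ sumFrom-swap (λ ℓ k → fromBool (u * k ≤ᵇ ℓ) * suc k) 0 (suc h) 1 Q ⟩
    sumFrom (λ k → sumFrom (λ ℓ → fromBool (u * k ≤ᵇ ℓ) * suc k) 1 Q) 0 (suc h)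
      ≡⟨ sumFrom-cong _ _ 0 (suc h) (λ k _ _ → sumFrom-*ʳ (λ ℓ → fromBool (u * k ≤ᵇ ℓ)) (suc k) 1 Q) ⟩
    levelsAbove (u * 0) * 1 + sumFrom (λ k → levelsAbove (u * k) * suc k) 1 h
      ≡⟨ cong (λ n → n * 1 + sumFrom (λ k → levelsAbove (u * k) * suc k) 1 h) all-levels ⟩
    Q * 1 + sumFrom (λ k → levelsAbove (u * k) * suc k) 1 h
      ≡⟨ cong (_+ sumFrom (λ k → levelsAbove (u * k) * suc k) 1 h) (*-identityʳ Q) ⟩
    Q + sumFrom (λ k → levelsAbove (u * k) * suc k) 1 h ∎
    where
    open ≡-Reasoning
    all-levels : levelsAbove (u * 0) ≡ Q
    all-levels = sumFrom-≤ᵇ-all (u * 0) 1 Q (subst (_≤ 1) (sym (*-zeroʳ u)) z≤n)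

  levelsAbove-block : ∀ k → 0 < k → k ≤ h → levelsAbove (u * k) + u * k ≡ 1 + Q
  levelsAbove-block k 0<k k≤h = sumFrom-≤ᵇ (u * k) 1 Q (≤-trans 0<k (m≤n*m k u))
    (≤-trans (*-monoʳ-≤ u k≤h) (≤-trans (m≤m+n (u * h) i) (n≤1+n _)))

  blocks+pronic : sumFrom (λ k → levelsAbove (u * k) * suc k) 1 h + u * sumFrom (λ k → k * suc k) 1 h
                  ≡ suc Q * sumFrom suc 1 h
  blocks+pronic = begin
    sumFrom (λ k → levelsAbove (u * k) * suc k) 1 h + u * sumFrom (λ k → k * suc k) 1 h
      ≡⟨ cong (sumFrom (λ k → levelsAbove (u * k) * suc k) 1 h +_) (sumFrom-*ˡ (λ k → k * suc k) u 1 h) ⟨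
    sumFrom (λ k → levelsAbove (u * k) * suc k) 1 h + sumFrom (λ k → u * (k * suc k)) 1 h
      ≡⟨ sumFrom-+ (λ k → levelsAbove (u * k) * suc k) (λ k → u * (k * suc k)) 1 h ⟨
    sumFrom (λ k → levelsAbove (u * k) * suc k + u * (k * suc k)) 1 h
      ≡⟨ sumFrom-cong _ _ 1 h (λ k 1≤k k<1+h → trans (factor (levelsAbove (u * k)) u k)
                                                      (cong (_* suc k) (levelsAbove-block k 1≤k (≤-pred k<1+h)))) ⟩
    sumFrom (λ k → suc Q * suc k) 1 h
      ≡⟨ sumFrom-*ˡ suc (suc Q) 1 h ⟩
    suc Q * sumFrom suc 1 h ∎
    where
    open ≡-Reasoning
    factor : ∀ c u k → c * suc k + u * (k * suc k) ≡ (c + u * k) * suc k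
    factor = solve-∀

  topLevelCount≡ : topLevelCount ≡ 3 + h + sumFrom suc 1 h
  topLevelCount≡ = cong (suc (suc (suc h)) +_) (sumFrom-cong _ suc 1 h (λ k _ k<1+h → full-block (≤-pred k<1+h)))
    where
    full-block : ∀ {k} → k ≤ h → blockCount (suc Q) k ≡ suc k
    full-block {k} k≤h = trans (cong (λ b → fromBool b * suc k)
      (≤⇒≤ᵇ≡true (≤-trans (*-monoʳ-≤ u k≤h) (≤-trans (m≤m+n (u * h) i) (n≤1+n _))))) (+-identityʳ (suc k))

  -- Multiplied by 6 and with the sums replaced by their closed forms, both sides become the same
  -- polynomial in h0 and i.
  eliahou-arithmetic : 3 * sumFrom levelCount 1 Q + triangular h0 ≡ Q * topLevelCount
  eliahou-arithmetic = *-cancelˡ-≡ _ _ 6 (+-cancelʳ-≡ (18 * (u * P)) _ _ (begin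
    6 * (3 * L + T) + 18 * (u * P)
      ≡⟨ cong (λ w → 6 * (3 * w + T) + 18 * (u * P)) count-L-by-blocks ⟩
    6 * (3 * (Q + B) + T) + 18 * (u * P)
      ≡⟨ expand₁ Q B T (u * P) ⟩
    18 * Q + 18 * (B + u * P) + 3 * (2 * T)
      ≡⟨ cong₂ (λ x y → 18 * Q + 18 * x + 3 * y) blocks+pronic (triangular-closed h0) ⟩
    18 * Q + 18 * (suc Q * Σ) + 3 * (h0 * h)
      ≡⟨ expand₂ Q Σ (h0 * h) ⟩
    18 * Q + 9 * suc Q * (2 * Σ) + 3 * (h0 * h)
      ≡⟨ cong (λ x → 18 * Q + 9 * suc Q * x + 3 * (h0 * h)) (sumFrom-suc-closed h) ⟩
    18 * Q + 9 * suc Q * (h * (h + 3)) + 3 * (h0 * h)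
      ≡⟨ polynomial h0 i ⟩
    6 * (Q * (3 + h)) + 3 * Q * (h * (h + 3)) + 6 * u * (h * suc h * suc (suc h))
      ≡⟨ cong₂ (λ x y → 6 * (Q * (3 + h)) + 3 * Q * x + 6 * u * y) (sumFrom-suc-closed h) (sumFrom-pronic-closed h) ⟨
    6 * (Q * (3 + h)) + 3 * Q * (2 * Σ) + 6 * u * (3 * P)
      ≡⟨ collect Q h Σ u P ⟩
    6 * (Q * (3 + h + Σ)) + 18 * (u * P)
      ≡⟨ cong (λ x → 6 * (Q * x) + 18 * (u * P)) topLevelCount≡ ⟨
    6 * (Q * topLevelCount) + 18 * (u * P) ∎))
    where
    open ≡-Reasoning
    L B Σ P T : ℕ
    L = sumFrom levelCount 1 Q
    B = sumFrom (λ k → levelsAbove (u * k) * suc k) 1 h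
    Σ = sumFrom suc 1 h
    P = sumFrom (λ k → k * suc k) 1 h
    T = triangular h0
    expand₁ : ∀ Q B T X → 6 * (3 * (Q + B) + T) + 18 * X ≡ 18 * Q + 18 * (B + X) + 3 * (2 * T)
    expand₁ = solve-∀
    expand₂ : ∀ Q Σ Y → 18 * Q + 18 * (suc Q * Σ) + 3 * Y ≡ 18 * Q + 9 * suc Q * (2 * Σ) + 3 * Y
    expand₂ = solve-∀
    polynomial : ∀ h0 i →
      18 * ((2 + i) * suc h0 + i) + 9 * suc ((2 + i) * suc h0 + i) * (suc h0 * (suc h0 + 3)) + 3 * (h0 * suc h0)
      ≡ 6 * (((2 + i) * suc h0 + i) * (3 + suc h0)) + 3 * ((2 + i) * suc h0 + i) * (suc h0 * (suc h0 + 3))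
        + 6 * (2 + i) * (suc h0 * suc (suc h0) * suc (suc (suc h0)))
    polynomial = solve-∀
    collect : ∀ Q h Σ u P → 6 * (Q * (3 + h)) + 3 * Q * (2 * Σ) + 6 * u * (3 * P) ≡ 6 * (Q * (3 + h + Σ)) + 18 * (u * P)
    collect = solve-∀

  eliahou-family : E-gen M G C ≡ τ ⊖ triangular h0
  eliahou-family = begin
    eliahouFrom S C
      ≡⟨ eliahouFrom-≡ S C conductor≡C multiplicity≡M ⟩
    (ℤ.+ (countBelow (isMinGen S) C * countBelow S C) ℤ.- ℤ.+ (ceilDiv C M * countBelow (λ t → not (isMinGen S (C + t))) M))
      ℤ.+ ℤ.+ (ceilDiv C M * M ∸ C)
      ≡⟨ cong₂ (λ x y → (ℤ.+ x ℤ.- ℤ.+ y) ℤ.+ ℤ.+ (ceilDiv C M * M ∸ C))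
               (cong₂ _*_ count-PL count-L) (cong₂ _*_ ceilDiv≡Q count-Dq) ⟩
    (ℤ.+ (3 * sumFrom levelCount 1 Q) ℤ.- ℤ.+ (Q * topLevelCount)) ℤ.+ ℤ.+ (ceilDiv C M * M ∸ C)
      ≡⟨ cong (λ q → (ℤ.+ (3 * sumFrom levelCount 1 Q) ℤ.- ℤ.+ (Q * topLevelCount)) ℤ.+ ℤ.+ (q * M ∸ C)) ceilDiv≡Q ⟩
    (ℤ.+ (3 * sumFrom levelCount 1 Q) ℤ.- ℤ.+ (Q * topLevelCount)) ℤ.+ ℤ.+ (Q * M ∸ C)
      ≡⟨ cong (λ ρ → (ℤ.+ (3 * sumFrom levelCount 1 Q) ℤ.- ℤ.+ (Q * topLevelCount)) ℤ.+ ℤ.+ ρ) ρ≡τ ⟩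
    (ℤ.+ (3 * sumFrom levelCount 1 Q) ℤ.- ℤ.+ (Q * topLevelCount)) ℤ.+ ℤ.+ τ
      ≡⟨ [a-b]+τ≡τ⊖t (triangular h0) τ eliahou-arithmetic ⟩
    τ ⊖ triangular h0 ∎
    where open ≡-Reasoning

-- The paper's parametrisation

eliahou-instance : ∀ {p h H} h0 τ i j {m g c} → p ≡ 2 * h → h ≡ suc h0 → H ≡ 2 * (h * h) →
  let μ = h * h + 2 * p + 2
      γ = 2 * μ ∸ (h + 4)
  in m ≡ μ + τ * h + j * h → g ≡ γ + τ * (p ∸ 1) + j * (p ∸ 1) + i * m →
     c ≡ p * μ + τ * (H ∸ 1) + j * H + i * (h + 1) * m → E-gen m g c ≡ τ ⊖ triangular h0
eliahou-instance h0 τ i j {m} {g} {c} refl refl refl m≡ g≡ c≡ = begin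
  E-gen m g c                    ≡⟨ cong (E-gen m g) c≡Qm∸τ ⟩
  E-gen m g (Q * m ∸ τ)          ≡⟨ Family.eliahou-family h0 τ j i E m g refl m≡2+h[1+E] g+1+E≡[2+i]m ⟩
  τ ⊖ triangular h0              ∎
  where
  open ≡-Reasoning
  h p H μ γ E Q : ℕ
  h = suc h0
  p = 2 * h
  H = 2 * (h * h)
  μ = h * h + 2 * p + 2
  γ = 2 * μ ∸ (h + 4)
  E = 3 + h + τ + j
  Q = (2 + i) * h + i
  γ+h+4≡2μ : γ + (h + 4) ≡ 2 * μ
  γ+h+4≡2μ = m∸n+n≡m (subst (h + 4 ≤_) (sym (expand h)) (m≤m+n (h + 4) _))
    where
    expand : ∀ h → 2 * (h * h + 2 * (2 * h) + 2) ≡ h + 4 + (2 * (h * h) + 7 * h)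
    expand = solve-∀
  p∸1+1≡p : p ∸ 1 + 1 ≡ p
  p∸1+1≡p = m∸n+n≡m (s≤s z≤n)
  H∸1+1≡H : H ∸ 1 + 1 ≡ H
  H∸1+1≡H = m∸n+n≡m (s≤s z≤n)
  m≡2+h[1+E] : m ≡ 2 + h * suc E
  m≡2+h[1+E] = trans m≡ (expand h τ j)
    where
    expand : ∀ h τ j → h * h + 2 * (2 * h) + 2 + τ * h + j * h ≡ 2 + h * suc (3 + h + τ + j)
    expand = solve-∀
  g+1+E≡[2+i]m : g + suc E ≡ (2 + i) * m
  g+1+E≡[2+i]m = begin
    g + suc E
      ≡⟨ cong (_+ suc E) g≡ ⟩
    γ + τ * (p ∸ 1) + j * (p ∸ 1) + i * m + suc E
      ≡⟨ regroup γ (p ∸ 1) τ j i m h ⟩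
    γ + (h + 4) + τ * (p ∸ 1 + 1) + j * (p ∸ 1 + 1) + i * m
      ≡⟨ cong₂ (λ a b → a + τ * b + j * b + i * m) γ+h+4≡2μ p∸1+1≡p ⟩
    2 * μ + τ * p + j * p + i * m
      ≡⟨ double μ h τ j (i * m) ⟩
    2 * (μ + τ * h + j * h) + i * m
      ≡⟨ cong (λ x → 2 * x + i * m) m≡ ⟨
    2 * m + i * m
      ≡⟨ *-distribʳ-+ m 2 i ⟨
    (2 + i) * m ∎
    where
    regroup : ∀ γ w τ j i m h →
              γ + τ * w + j * w + i * m + suc (3 + h + τ + j) ≡ γ + (h + 4) + τ * (w + 1) + j * (w + 1) + i * m
    regroup = solve-∀
    double : ∀ μ h τ j r → 2 * μ + τ * (2 * h) + j * (2 * h) + r ≡ 2 * (μ + τ * h + j * h) + r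
    double = solve-∀
  c≡Qm∸τ : c ≡ Q * m ∸ τ
  c≡Qm∸τ = trans (sym (m+n∸n≡m c τ)) (cong (_∸ τ) (begin
    c + τ
      ≡⟨ cong (_+ τ) c≡ ⟩
    p * μ + τ * (H ∸ 1) + j * H + i * (h + 1) * m + τ
      ≡⟨ regroup (p * μ) τ (H ∸ 1) j H (i * (h + 1) * m) ⟩
    p * μ + τ * (H ∸ 1 + 1) + j * H + i * (h + 1) * m
      ≡⟨ cong (λ x → p * μ + τ * x + j * H + i * (h + 1) * m) H∸1+1≡H ⟩
    p * μ + τ * H + j * H + i * (h + 1) * m
      ≡⟨ factor μ h τ j (i * (h + 1) * m) ⟩
    2 * h * (μ + τ * h + j * h) + i * (h + 1) * m
      ≡⟨ cong (λ x → 2 * h * x + i * (h + 1) * m) m≡ ⟨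
    2 * h * m + i * (h + 1) * m
      ≡⟨ collect h i m ⟩
    Q * m ∎))
    where
    regroup : ∀ a τ w j b r → a + τ * w + j * b + r + τ ≡ a + τ * (w + 1) + j * b + r
    regroup = solve-∀
    factor : ∀ μ h τ j r → 2 * h * μ + τ * (2 * (h * h)) + j * (2 * (h * h)) + r ≡ 2 * h * (μ + τ * h + j * h) + r
    factor = solve-∀
    collect : ∀ h i m → 2 * h * m + i * (h + 1) * m ≡ ((2 + i) * h + i) * m
    collect = solve-∀

theorem5p14 : (p τ i j : ℕ) → 0 < p → 2 ∣ p →
    let h   = p / 2
        μ   = h * h + 2 * p + 2
        γ   = 2 * μ ∸ (h + 4)
        m   = μ + τ * h
        g   = γ + τ * (p ∸ 1)
        c   = p * μ + τ * (p * p / 2 ∸ 1)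
        mij = m + j * h
        gij = g + j * (p ∸ 1) + i * mij
        cij = c + j * (p * p / 2) + i * (h + 1) * mij
    in E-gen mij gij cij ≡ E-gen m g c
theorem5p14 p τ i j 0<p (divides zero p≡0) = contradiction p≡0 (>⇒≢ 0<p)
-- S(p, τ) itself is the instance i = j = 0.
theorem5p14 p τ i j 0<p (divides (suc h0) p≡[1+h0]2) =
  trans (eliahou-instance h0 τ i j p≡2h h≡1+h0 H≡2hh refl refl refl)
        (sym (eliahou-instance h0 τ 0 0 p≡2h h≡1+h0 H≡2hh (sym (+-identityʳ _))
                               (sym (trans (+-identityʳ _) (+-identityʳ _))) (sym (trans (+-identityʳ _) (+-identityʳ _)))))
  where
  h≡1+h0 : p / 2 ≡ suc h0
  h≡1+h0 = trans (cong (_/ 2) p≡[1+h0]2) (m*n/n≡m (suc h0) 2)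
  p≡2h : p ≡ 2 * (p / 2)
  p≡2h = trans p≡[1+h0]2 (trans (*-comm (suc h0) 2) (cong (2 *_) (sym h≡1+h0)))
  H≡2hh : p * p / 2 ≡ 2 * (p / 2 * (p / 2))
  H≡2hh = begin
    p * p / 2                      ≡⟨ cong (λ q → q * q / 2) p≡[1+h0]2 ⟩
    suc h0 * 2 * (suc h0 * 2) / 2  ≡⟨ cong (_/ 2) (rearrange h0) ⟩
    2 * (suc h0 * suc h0) * 2 / 2  ≡⟨ m*n/n≡m (2 * (suc h0 * suc h0)) 2 ⟩
    2 * (suc h0 * suc h0)          ≡⟨ cong (λ q → 2 * (q * q)) h≡1+h0 ⟨
    2 * (p / 2 * (p / 2))          ∎
    where
    open ≡-Reasoning
    rearrange : ∀ h0 → suc h0 * 2 * (suc h0 * 2) ≡ 2 * (suc h0 * suc h0) * 2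
    rearrange = solve-∀
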